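{- Let $\mathbb F$ be a finite field of odd order with $|\mathbb F|>9$. Then there exist $u,v\in\mathbb F$ such that $\chi(u)=\chi(v)=\chi(u+1)=\chi(v+1)=\chi(u-1)=-1$ and $\chi(v-1)=1$.
   Context: $\chi$ is the quadratic character of $\mathbb F$: $\chi(0)=0$, $\chi(x)=1$ if $x$ is a nonzero square, $\chi(x)=-1$ otherwise. -}

module Defs where

open import Level using (0ℓ)
open import Data.Nat using (ℕ)
open import Data.Fin using (Fin)
import Data.Fin.Properties as FinP
open import Data.Integer using (ℤ; 0ℤ; 1ℤ; -1ℤ)
open import Data.Product using (∃; _,_)
open import Relation.Nullary using (¬_; Dec; yes; no)
import Relation.Nullary.Decidable as Dec
open import Relation.Binary.PropositionalEquality
  using (_≡_; _≢_; refl; sym; trans; cong)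
open import Algebra.Structures using (IsCommutativeRing)
open import Function.Bundles using (_↔_; Inverse)

record FiniteField : Set₁ where
  infixl 7 _*_
  infixl 6 _+_ _-_
  field
    Carrier : Set
    _+_     : Carrier → Carrier → Carrier
    _*_     : Carrier → Carrier → Carrier
    -_      : Carrier → Carrier
    0#      : Carrier
    1#      : Carrier
    isCommutativeRing : IsCommutativeRing _≡_ _+_ _*_ -_ 0# 1#
    0≢1     : 0# ≢ 1#
    inverse : ∀ x → x ≢ 0# → ∃ λ y → x * y ≡ 1#
    order   : ℕ
    enum    : Carrier ↔ Fin order

  _-_ : Carrier → Carrier → Carrier
  x - y = x + (- y)

  private
    module E = Inverse enum

  _≟_ : (x y : Carrier) → Dec (x ≡ y)
  x ≟ y = Dec.map′
    (λ e → trans (sym (E.strictlyInverseʳ x)) (trans (cong E.from e) (E.strictlyInverseʳ y)))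
    (cong E.to)
    (E.to x FinP.≟ E.to y)

  IsSquare : Carrier → Set
  IsSquare x = ∃ λ y → y * y ≡ x

  isSquare? : (x : Carrier) → Dec (IsSquare x)
  isSquare? x = Dec.map′
    (λ { (i , e) → E.from i , e })
    (λ { (y , e) → E.to y , trans (cong (λ z → z * z) (E.strictlyInverseʳ y)) e })
    (FinP.any? (λ i → (E.from i * E.from i) ≟ x))

  χ : Carrier → ℤ
  χ x with x ≟ 0#
  ... | yes _ = 0ℤ
  ... | no _ with isSquare? x
  ...   | yes _ = 1ℤ
  ...   | no _  = -1ℤ

-- For ε = ±1 weigh each u by
--   P ε u = (1 − ε χ(u − 1)) (1 − χ u) (1 − χ(u + 1)),
-- which for u ≠ −1 is positive only if χ(u − 1) = −ε and χ u = χ(u + 1) = −1.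
-- Expanding the product, ∑ P ε = q − 1 − 2ε − ε S: the sums of χ vanish, every
-- correlation ∑ₓ χ(x) χ(x + c) with c ≠ 0 equals −1, and S = ∑ᵤ χ(u − 1) χ(u) χ(u + 1)
-- is the Jacobsthal sum φ(−1), where φ(e) = ∑ₓ χ(x) χ(x² + e).
-- If χ(−1) = −1, the substitution x ↦ −x gives φ = 0, so S = 0.
-- If χ(−1) = 1, then −1 is a square, φ(e)² is the same for all nonzero squares e, and the
-- second moment ∑ₑ φ(e)² = 2q(q − 1) yields S² ≤ 4q.
-- For q ≥ 11 either way ∑ P ε exceeds the weight P ε (−1) ≤ 4, so some u ≠ −1 has positive weight.

module Submission where

open import Defs
open import Algebra.Bundles using (CommutativeRing)
open import Data.Empty using (⊥; ⊥-elim)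
open import Data.Fin as Fin using (Fin; toℕ)
import Data.Fin.Properties as Fin
open import Data.Integer as ℤ using (ℤ; 0ℤ; 1ℤ; -1ℤ)
import Data.Integer.Properties as ℤ
open import Data.Integer.Tactic.RingSolver using (solve-∀)
open import Data.Maybe using (map)
open import Data.Nat as ℕ using (ℕ; zero; suc)
import Data.Nat.Properties as ℕ
open import Data.Nat.DivMod using (m*n%n≡0)
import Data.Nat.Tactic.RingSolver as ℕ-Solver
open import Data.Product using (∃; ∃₂; _×_; _,_; proj₁; proj₂; map₂)
open import Data.Sum using (_⊎_; inj₁; inj₂)
open import Function using (_∘_; _∘′_; _↔_; Inverse; mk↔ₛ′)
open import Function.Construct.Composition using (_↔-∘_)
open import Function.Construct.Symmetry using (↔-sym)
open import Relation.Nullary using (¬_; Dec; yes; no)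
open import Relation.Nullary.Decidable using (dec⇒maybe)
open import Relation.Binary.Definitions using (DecidableEquality)
open import Relation.Binary.PropositionalEquality
  using (_≡_; _≢_; refl; sym; trans; cong; cong₂; subst; subst₂; module ≡-Reasoning)

module IntegerCoefficients {c ℓ} (R : CommutativeRing c ℓ) where

  open CommutativeRing R
    renaming (refl to ≈-refl; sym to ≈-sym; trans to ≈-trans; reflexive to ≈-reflexive)
    hiding (zero)
  open import Data.Integer using (+_; -[1+_]; _⊖_)
  open import Algebra.Properties.Ring ring using (-0#≈0#; -‿involutive; -‿+-comm; -‿distribˡ-*; -‿distribʳ-*)
  open import Algebra.Properties.CommutativeSemigroup +-commutativeSemigroup using (interchange)
  open import Algebra.Properties.Monoid.Mult.TCOptimised +-monoid using (×-homo-+) renaming (_×_ to _·_)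
  open import Algebra.Properties.Semiring.Mult.TCOptimised semiring using (×1-homo-*)
  open import Algebra.Solver.Ring.AlmostCommutativeRing
    using (AlmostCommutativeRing; fromCommutativeRing; _-Raw-AlmostCommutative⟶_)
  open import Relation.Binary.Reasoning.Setoid setoid

  -- With the TCOptimised multiple, 1 · x reduces to x, so ι 1ℤ is 1# by definition and
  -- the solver closes goals with constants by refl.
  ι : ℤ → Carrier
  ι (+ n)    = n · 1#
  ι -[1+ n ] = - (suc n · 1#)

  ι-neg : ∀ z → ι (ℤ.- z) ≈ - ι z
  ι-neg (+ zero)  = ≈-sym -0#≈0#
  ι-neg (+ suc n) = ≈-refl
  ι-neg -[1+ n ]  = ≈-sym (-‿involutive _)

  ι-⊖ : ∀ m n → ι (m ⊖ n) ≈ m · 1# - n · 1#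
  ι-⊖ zero    zero    = ≈-sym (-‿inverseʳ 0#)
  ι-⊖ zero    (suc n) = ≈-sym (+-identityˡ _)
  ι-⊖ (suc m) zero    = ≈-sym (≈-trans (+-congˡ -0#≈0#) (+-identityʳ _))
  ι-⊖ (suc m) (suc n) = begin
    ι (suc m ⊖ suc n)                 ≡⟨ cong ι (ℤ.[1+m]⊖[1+n]≡m⊖n m n) ⟩
    ι (m ⊖ n)                         ≈⟨ ι-⊖ m n ⟩
    m · 1# - n · 1#                   ≈⟨ +-identityˡ _ ⟨
    0# + (m · 1# - n · 1#)            ≈⟨ +-congʳ (-‿inverseʳ 1#) ⟨
    (1# - 1#) + (m · 1# - n · 1#)     ≈⟨ interchange 1# (- 1#) _ _ ⟩
    (1# + m · 1#) + (- 1# - n · 1#)   ≈⟨ +-congˡ (-‿+-comm 1# _) ⟩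
    (1# + m · 1#) - (1# + n · 1#)     ≈⟨ +-cong (×-homo-+ 1# 1 m) (-‿cong (×-homo-+ 1# 1 n)) ⟨
    suc m · 1# - suc n · 1#           ∎

  ι-+ : ∀ z w → ι (z ℤ.+ w) ≈ ι z + ι w
  ι-+ (+ m)    (+ n)    = ×-homo-+ 1# m n
  ι-+ (+ m)    -[1+ n ] = ι-⊖ m (suc n)
  ι-+ -[1+ m ] (+ n)    = ≈-trans (ι-⊖ n (suc m)) (+-comm _ _)
  ι-+ -[1+ m ] -[1+ n ] = begin
    - (suc (suc (m ℕ.+ n)) · 1#)      ≡⟨ cong (λ k → - (k · 1#)) (ℕ.+-suc (suc m) n) ⟨
    - ((suc m ℕ.+ suc n) · 1#)        ≈⟨ -‿cong (×-homo-+ 1# (suc m) (suc n)) ⟩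
    - (suc m · 1# + suc n · 1#)       ≈⟨ -‿+-comm _ _ ⟨
    - (suc m · 1#) - suc n · 1#       ∎

  ι-*-pos : ∀ m w → ι (+ m ℤ.* w) ≈ ι (+ m) * ι w
  ι-*-pos m (+ n) = ≈-trans (≈-reflexive (cong ι (sym (ℤ.pos-* m n)))) (×1-homo-* m n)
  ι-*-pos m -[1+ n ] = begin
    ι (+ m ℤ.* ℤ.- + suc n)           ≡⟨ cong ι (ℤ.neg-distribʳ-* (+ m) (+ suc n)) ⟨
    ι (ℤ.- (+ m ℤ.* + suc n))         ≈⟨ ι-neg (+ m ℤ.* + suc n) ⟩
    - ι (+ m ℤ.* + suc n)             ≈⟨ -‿cong (ι-*-pos m (+ suc n)) ⟩
    - (ι (+ m) * ι (+ suc n))         ≈⟨ -‿distribʳ-* _ _ ⟩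
    ι (+ m) * ι -[1+ n ]              ∎

  ι-* : ∀ z w → ι (z ℤ.* w) ≈ ι z * ι w
  ι-* (+ m)    w = ι-*-pos m w
  ι-* -[1+ m ] w = begin
    ι (ℤ.- + suc m ℤ.* w)             ≡⟨ cong ι (ℤ.neg-distribˡ-* (+ suc m) w) ⟨
    ι (ℤ.- (+ suc m ℤ.* w))           ≈⟨ ι-neg (+ suc m ℤ.* w) ⟩
    - ι (+ suc m ℤ.* w)               ≈⟨ -‿cong (ι-*-pos (suc m) w) ⟩
    - (ι (+ suc m) * ι w)             ≈⟨ -‿distribˡ-* _ _ ⟩
    ι -[1+ m ] * ι w                  ∎

  almostCommutativeRing : AlmostCommutativeRing c ℓ
  almostCommutativeRing = fromCommutativeRing R

  ι-homomorphism : ℤ.+-*-rawRing -Raw-AlmostCommutative⟶ almostCommutativeRing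
  ι-homomorphism = record
    { ⟦_⟧ = ι ; +-homo = ι-+ ; *-homo = ι-* ; -‿homo = ι-neg
    ; 0-homo = ≈-refl ; 1-homo = ≈-refl }

  open import Algebra.Solver.Ring ℤ.+-*-rawRing almostCommutativeRing ι-homomorphism
    (λ a b → map (λ a≡b → ≈-reflexive (cong ι a≡b)) (dec⇒maybe (a ℤ.≟ b))) public
    using (solve; _:=_; _:+_; _:*_; :-_; _:-_; con)

module FiniteSum {A : Set} {n : ℕ} (enum : A ↔ Fin n) (_≟_ : DecidableEquality A) where

  open import Data.Integer using (+_; _+_; _*_; -_; _-_; _≤_; _<_)
  open Inverse enum using (to; from; strictlyInverseˡ; strictlyInverseʳ)
  open import Algebra.Properties.Semiring.Sum ℤ.+-*-semiring
    using (sum; sum-cong-≗; sum-remove; sum-replicate-zero; ∑-comm; sum-permute; *-distribˡ-sum)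
    renaming (∑-distrib-+ to sum-distrib-+)
  open ≡-Reasoning

  ∑ : (A → ℤ) → ℤ
  ∑ f = sum (f ∘ from)

  ∑-cong : ∀ {f g} → (∀ x → f x ≡ g x) → ∑ f ≡ ∑ g
  ∑-cong f≗g = sum-cong-≗ (f≗g ∘ from)

  ∑-distrib-+ : ∀ f g → ∑ (λ x → f x + g x) ≡ ∑ f + ∑ g
  ∑-distrib-+ f g = sum-distrib-+ (f ∘ from) (g ∘ from)

  *-distribˡ-∑ : ∀ c f → c * ∑ f ≡ ∑ (λ x → c * f x)
  *-distribˡ-∑ c f = *-distribˡ-sum c (f ∘ from)

  *-distribʳ-∑ : ∀ c f → ∑ f * c ≡ ∑ (λ x → f x * c)
  *-distribʳ-∑ c f = begin
    ∑ f * c               ≡⟨ ℤ.*-comm (∑ f) c ⟩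
    c * ∑ f               ≡⟨ *-distribˡ-∑ c f ⟩
    ∑ (λ x → c * f x)     ≡⟨ ∑-cong (λ x → ℤ.*-comm c (f x)) ⟩
    ∑ (λ x → f x * c)     ∎

  ∑-neg : ∀ f → ∑ (λ x → - f x) ≡ - ∑ f
  ∑-neg f = begin
    ∑ (λ x → - f x)       ≡⟨ ∑-cong (λ x → ℤ.-1*i≡-i (f x)) ⟨
    ∑ (λ x → -1ℤ * f x)   ≡⟨ *-distribˡ-∑ -1ℤ f ⟨
    -1ℤ * ∑ f             ≡⟨ ℤ.-1*i≡-i (∑ f) ⟩
    - ∑ f                 ∎

  ∑-distrib-- : ∀ f g → ∑ (λ x → f x - g x) ≡ ∑ f - ∑ g
  ∑-distrib-- f g = trans (∑-distrib-+ f (λ x → - g x)) (cong (_+_ (∑ f)) (∑-neg g))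

  ∑-const : ∀ c → ∑ (λ _ → c) ≡ + n * c
  ∑-const c = go n
    where
    go : ∀ m → sum {m} (λ _ → c) ≡ + m * c
    go zero    = sym (ℤ.*-zeroˡ c)
    go (suc m) = begin
      c + sum {m} (λ _ → c) ≡⟨ cong₂ _+_ (ℤ.*-identityˡ c) (sym (go m)) ⟨
      1ℤ * c + + m * c      ≡⟨ ℤ.*-distribʳ-+ c 1ℤ (+ m) ⟨
      (1ℤ + + m) * c        ≡⟨ cong (_* c) (ℤ.pos-+ 1 m) ⟨
      + suc m * c           ∎

  ∑-zero : ∑ (λ _ → 0ℤ) ≡ 0ℤ
  ∑-zero = trans (∑-const 0ℤ) (ℤ.*-zeroʳ (+ n))

  ∑1≡n : ∑ (λ _ → 1ℤ) ≡ + n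
  ∑1≡n = trans (∑-const 1ℤ) (ℤ.*-identityʳ (+ n))

  ∑-expand₃ : ∀ (a b c : A → ℤ) →
    ∑ (λ x → (1ℤ - a x) * (1ℤ - b x) * (1ℤ - c x)) ≡
    + n - ∑ a - ∑ b - ∑ c + ∑ (λ x → a x * b x) + ∑ (λ x → b x * c x) + ∑ (λ x → a x * c x)
      - ∑ (λ x → a x * b x * c x)
  ∑-expand₃ a b c = begin
    ∑ (λ x → (1ℤ - a x) * (1ℤ - b x) * (1ℤ - c x))    ≡⟨ ∑-cong (λ x → expand (a x) (b x) (c x)) ⟩
    ∑ (λ x → p₆ x - abc x)                            ≡⟨ ∑-distrib-- p₆ abc ⟩
    ∑ p₆ - ∑ abc                                      ≡⟨ cong (_- ∑ abc) (∑-distrib-+ p₅ ac) ⟩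
    ∑ p₅ + ∑ ac - ∑ abc                               ≡⟨ cong (λ s → s + ∑ ac - ∑ abc) (∑-distrib-+ p₄ bc) ⟩
    ∑ p₄ + ∑ bc + ∑ ac - ∑ abc                        ≡⟨ cong (λ s → s + ∑ bc + ∑ ac - ∑ abc) (∑-distrib-+ p₃ ab) ⟩
    ∑ p₃ + ∑ ab + ∑ bc + ∑ ac - ∑ abc                 ≡⟨ cong (λ s → s + ∑ ab + ∑ bc + ∑ ac - ∑ abc) linear ⟩
    + n - ∑ a - ∑ b - ∑ c + ∑ ab + ∑ bc + ∑ ac - ∑ abc ∎
    where
    ab bc ac abc p₃ p₄ p₅ p₆ : A → ℤ
    ab x  = a x * b x
    bc x  = b x * c x
    ac x  = a x * c x
    abc x = a x * b x * c x
    p₃ x  = 1ℤ - a x - b x - c x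
    p₄ x  = p₃ x + ab x
    p₅ x  = p₄ x + bc x
    p₆ x  = p₅ x + ac x

    expand : ∀ a b c → (1ℤ - a) * (1ℤ - b) * (1ℤ - c) ≡ 1ℤ - a - b - c + a * b + b * c + a * c - a * b * c
    expand = solve-∀

    linear : ∑ p₃ ≡ + n - ∑ a - ∑ b - ∑ c
    linear = begin
      ∑ p₃                                         ≡⟨ ∑-distrib-- (λ x → 1ℤ - a x - b x) c ⟩
      ∑ (λ x → 1ℤ - a x - b x) - ∑ c               ≡⟨ cong (_- ∑ c) (∑-distrib-- (λ x → 1ℤ - a x) b) ⟩
      ∑ (λ x → 1ℤ - a x) - ∑ b - ∑ c               ≡⟨ cong (λ s → s - ∑ b - ∑ c) (∑-distrib-- (λ _ → 1ℤ) a) ⟩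
      ∑ (λ _ → 1ℤ) - ∑ a - ∑ b - ∑ c               ≡⟨ cong (λ s → s - ∑ a - ∑ b - ∑ c) ∑1≡n ⟩
      + n - ∑ a - ∑ b - ∑ c                        ∎

  ∑-mono-≤ : ∀ {f g} → (∀ x → f x ≤ g x) → ∑ f ≤ ∑ g
  ∑-mono-≤ f≤g = go (f≤g ∘ from)
    where
    go : ∀ {m} {f g : Fin m → ℤ} → (∀ i → f i ≤ g i) → sum f ≤ sum g
    go {zero}  _   = ℤ.≤-refl
    go {suc m} f≤g = ℤ.+-mono-≤ (f≤g Fin.zero) (go (f≤g ∘ Fin.suc))

  ∑-swap : ∀ (f : A → A → ℤ) → ∑ (λ x → ∑ (f x)) ≡ ∑ (λ y → ∑ (λ x → f x y))
  ∑-swap f = ∑-comm (λ i j → f (from i) (from j))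

  ∑*∑ : ∀ (f g : A → ℤ) → ∑ f * ∑ g ≡ ∑ (λ x → ∑ (λ y → f x * g y))
  ∑*∑ f g = trans (*-distribʳ-∑ (∑ g) f) (∑-cong (λ x → *-distribˡ-∑ (f x) g))

  ∑-reindex : ∀ (σ : A ↔ A) f → ∑ (f ∘ Inverse.to σ) ≡ ∑ f
  ∑-reindex σ f = sym (trans (sum-permute (f ∘ from) π)
                             (∑-cong (λ x → cong f (strictlyInverseʳ (Inverse.to σ x)))))
    where
    π : Fin n ↔ Fin n
    π = enum ↔-∘ (σ ↔-∘ ↔-sym enum)

  δ : A → A → ℤ
  δ x y with x ≟ y
  ... | yes _ = 1ℤ
  ... | no  _ = 0ℤ

  δ-≡ : ∀ {x y} → x ≡ y → δ x y ≡ 1ℤ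
  δ-≡ {x} {y} x≡y with x ≟ y
  ... | yes _   = refl
  ... | no  x≢y = ⊥-elim (x≢y x≡y)

  δ-≢ : ∀ {x y} → x ≢ y → δ x y ≡ 0ℤ
  δ-≢ {x} {y} x≢y with x ≟ y
  ... | yes x≡y = ⊥-elim (x≢y x≡y)
  ... | no  _   = refl

  ∑-supported : ∀ a (f : A → ℤ) → (∀ x → x ≢ a → f x ≡ 0ℤ) → ∑ f ≡ f a
  ∑-supported a f f≡0 = trans (go (to a) (f ∘ from) f∘from≡0) (cong f (strictlyInverseʳ a))
    where
    f∘from≡0 : ∀ i → i ≢ to a → f (from i) ≡ 0ℤ
    f∘from≡0 i i≢a = f≡0 (from i) (λ eq → i≢a (trans (sym (strictlyInverseˡ i)) (cong to eq)))
    go : ∀ {m} (i : Fin m) (t : Fin m → ℤ) → (∀ j → j ≢ i → t j ≡ 0ℤ) → sum t ≡ t i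
    go {suc m} i t t≡0 = begin
      sum t                             ≡⟨ sum-remove t ⟩
      t i + sum (t ∘ Fin.punchIn i)     ≡⟨ cong (_+_ (t i)) (sum-cong-≗ (λ j → t≡0 _ (Fin.punchInᵢ≢i i j))) ⟩
      t i + sum {m} (λ _ → 0ℤ)           ≡⟨ cong (_+_ (t i)) (sum-replicate-zero m) ⟩
      t i + 0ℤ                          ≡⟨ ℤ.+-identityʳ (t i) ⟩
      t i                               ∎

  ∑-δ : ∀ x (f : A → ℤ) → ∑ (λ y → δ x y * f y) ≡ f x
  ∑-δ x f = trans (∑-supported x (λ y → δ x y * f y) off) (trans (cong (λ d → d * f x) (δ-≡ {x} refl)) (ℤ.*-identityˡ (f x)))
    where
    off : ∀ y → y ≢ x → δ x y * f y ≡ 0ℤ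
    off y y≢x = trans (cong (λ d → d * f y) (δ-≢ (y≢x ∘ sym))) (ℤ.*-zeroˡ (f y))

  ∑δ≡1 : ∀ x → ∑ (δ x) ≡ 1ℤ
  ∑δ≡1 x = trans (∑-cong (λ y → sym (ℤ.*-identityʳ (δ x y)))) (∑-δ x (λ _ → 1ℤ))

  ∑≤term : ∀ a (f : A → ℤ) → (∀ x → x ≢ a → f x ≤ 0ℤ) → ∑ f ≤ f a
  ∑≤term a f f≤0 = ℤ.≤-trans (∑-mono-≤ f≤δf) (ℤ.≤-reflexive (∑-δ a f))
    where
    f≤δf : ∀ x → f x ≤ δ a x * f x
    f≤δf x with a ≟ x
    ... | yes refl = ℤ.≤-reflexive (sym (ℤ.*-identityˡ (f x)))
    ... | no  a≢x  = f≤0 x (a≢x ∘ sym)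

  nonPositive∧∑≡0⇒≡0 : ∀ (f : A → ℤ) → (∀ x → f x ≤ 0ℤ) → ∑ f ≡ 0ℤ → ∀ x → f x ≡ 0ℤ
  nonPositive∧∑≡0⇒≡0 f f≤0 ∑f≡0 x =
    ℤ.≤-antisym (f≤0 x) (ℤ.≤-trans (ℤ.≤-reflexive (sym ∑f≡0)) (∑≤term x f (λ y _ → f≤0 y)))

  term<∑⇒∃positive : ∀ a (f : A → ℤ) → f a < ∑ f → ∃ λ x → x ≢ a × 0ℤ < f x
  term<∑⇒∃positive a f fa<∑f with Fin.any? (λ i → positive-elsewhere? (from i))
    where
    positive-elsewhere? : ∀ x → Dec (x ≢ a × 0ℤ < f x)
    positive-elsewhere? x with x ≟ a | 0ℤ ℤ.<? f x
    ... | yes x≡a | _       = no (λ (x≢a , _) → x≢a x≡a)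
    ... | no  x≢a | yes 0<fx = yes (x≢a , 0<fx)
    ... | no  _   | no  0≮fx = no (λ (_ , 0<fx) → 0≮fx 0<fx)
  ... | yes (i , positive) = from i , positive
  ... | no  none = ⊥-elim (ℤ.<-irrefl refl (ℤ.<-≤-trans fa<∑f (∑≤term a f nonPositive)))
    where
    nonPositive : ∀ x → x ≢ a → f x ≤ 0ℤ
    nonPositive x x≢a = ℤ.≮⇒≥ (λ 0<fx →
      none (to x , subst (λ y → y ≢ a × 0ℤ < f y) (sym (strictlyInverseʳ x)) (x≢a , 0<fx)))

  fixedPointFree-involution⇒even : ∀ (f : A → A) → (∀ x → f (f x) ≡ x) → (∀ x → f x ≢ x) →
                                   ∃ λ t → n ≡ t ℕ.+ t
  fixedPointFree-involution⇒even f involutive fixedPointFree = ℤ.∣ ∑ half ∣ , ℤ.+-injective (begin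
    + n                             ≡⟨ ∑1≡n ⟨
    ∑ (λ _ → 1ℤ)                    ≡⟨ ∑-cong half-pair ⟨
    ∑ (λ x → half x + half (f x))   ≡⟨ ∑-distrib-+ half (half ∘ f) ⟩
    ∑ half + ∑ (half ∘ f)           ≡⟨ cong (_+_ (∑ half)) (∑-reindex (mk↔ₛ′ f f involutive involutive) half) ⟩
    ∑ half + ∑ half                 ≡⟨ cong₂ _+_ ∣∑half∣ ∣∑half∣ ⟨
    + ℤ.∣ ∑ half ∣ + + ℤ.∣ ∑ half ∣ ∎)
    where
    key : A → ℕ
    key x = toℕ (to x)

    key-injective : ∀ {x y} → key x ≡ key y → x ≡ y
    key-injective {x} {y} eq =
      trans (sym (strictlyInverseʳ x)) (trans (cong from (Fin.toℕ-injective eq)) (strictlyInverseʳ y))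

    -- whether x is the first of the pair {x, f x} in the enumeration
    half : A → ℤ
    half x with key x ℕ.<? key (f x)
    ... | yes _ = 1ℤ
    ... | no  _ = 0ℤ

    half-pair : ∀ x → half x + half (f x) ≡ 1ℤ
    half-pair x with key x ℕ.<? key (f x) | key (f x) ℕ.<? key (f (f x))
    ... | yes x<fx | yes fx<ffx =
      ⊥-elim (ℕ.<-asym x<fx (subst (λ y → key (f x) ℕ.< key y) (involutive x) fx<ffx))
    ... | yes _    | no  _      = refl
    ... | no  _    | yes _      = refl
    ... | no  x≮fx | no  fx≮ffx = ⊥-elim (fixedPointFree x (key-injective (ℕ.≤-antisym
      (ℕ.≮⇒≥ x≮fx) (subst (λ y → key y ℕ.≤ key (f x)) (involutive x) (ℕ.≮⇒≥ fx≮ffx)))))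

    ∣∑half∣ : + ℤ.∣ ∑ half ∣ ≡ ∑ half
    ∣∑half∣ = ℤ.0≤i⇒+∣i∣≡i (ℤ.≤-trans (ℤ.≤-reflexive (sym ∑-zero)) (∑-mono-≤ half≥0))
      where
      half≥0 : ∀ x → 0ℤ ≤ half x
      half≥0 x with key x ℕ.<? key (f x)
      ... | yes _ = ℤ.+≤+ ℕ.z≤n
      ... | no  _ = ℤ.≤-refl

-- Throughout, q = 11 + m.
module IntegerBounds where

  open import Data.Integer using (+_; _≤_; _<_)

  T²≤4q⇒T<q-3 : ∀ m T → T ℤ.* T ≤ + 4 ℤ.* + (11 ℕ.+ m) → T < + (8 ℕ.+ m)
  T²≤4q⇒T<q-3 m T T²≤ with T ℤ.<? + (8 ℕ.+ m)
  ... | yes T<8+m = T<8+m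
  ... | no  T≮8+m with ℤ.≮⇒≥ T≮8+m
  ...   | ℤ.+≤+ {n = t} 8+m≤t = ⊥-elim (ℕ.<⇒≱ 4[11+m]<t² (ℤ.drop‿+≤+ t²≤4[11+m]))
    where
    t²≤4[11+m] : + (t ℕ.* t) ≤ + (4 ℕ.* (11 ℕ.+ m))
    t²≤4[11+m] = subst₂ _≤_ (sym (ℤ.pos-* t t)) (sym (ℤ.pos-* 4 (11 ℕ.+ m))) T²≤
    expand : ∀ m → (8 ℕ.+ m) ℕ.* (8 ℕ.+ m) ≡ suc (4 ℕ.* (11 ℕ.+ m)) ℕ.+ (19 ℕ.+ 12 ℕ.* m ℕ.+ m ℕ.* m)
    expand = ℕ-Solver.solve-∀
    4[11+m]<t² : 4 ℕ.* (11 ℕ.+ m) ℕ.< t ℕ.* t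
    4[11+m]<t² = ℕ.≤-trans (ℕ.≤-trans (ℕ.m≤m+n _ _) (ℕ.≤-reflexive (sym (expand m)))) (ℕ.*-mono-≤ 8+m≤t 8+m≤t)

  s+p<q-3⇒p<q-1-2ε-s : ∀ m {ε s p} → ε ≡ 1ℤ ⊎ ε ≡ -1ℤ → s ℤ.+ p < + (8 ℕ.+ m) →
           p < + (11 ℕ.+ m) ℤ.- 1ℤ ℤ.- + 2 ℤ.* ε ℤ.- s
  s+p<q-3⇒p<q-1-2ε-s m {ε} {s} {p} ε≡±1 s+p<8+m = begin-strict
    p                           ≡⟨ cancel s p ⟩
    ℤ.- s ℤ.+ (s ℤ.+ p)         <⟨ ℤ.+-monoʳ-< (ℤ.- s) s+p<8+m ⟩
    ℤ.- s ℤ.+ + (8 ℕ.+ m)       ≤⟨ slack ε≡±1 ⟩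
    + (11 ℕ.+ m) ℤ.- 1ℤ ℤ.- + 2 ℤ.* ε ℤ.- s ∎
    where
    open ℤ.≤-Reasoning
    cancel : ∀ s p → p ≡ ℤ.- s ℤ.+ (s ℤ.+ p)
    cancel = solve-∀
    slack : ε ≡ 1ℤ ⊎ ε ≡ -1ℤ → ℤ.- s ℤ.+ + (8 ℕ.+ m) ≤ + (11 ℕ.+ m) ℤ.- 1ℤ ℤ.- + 2 ℤ.* ε ℤ.- s
    slack (inj₁ refl) = ℤ.≤-reflexive (begin-equality
      ℤ.- s ℤ.+ + (8 ℕ.+ m)                        ≡⟨ cong (ℤ._+_ (ℤ.- s)) (ℤ.pos-+ 8 m) ⟩
      ℤ.- s ℤ.+ (+ 8 ℤ.+ + m)                      ≡⟨ rearrange s (+ m) ⟩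
      + 11 ℤ.+ + m ℤ.- 1ℤ ℤ.- + 2 ℤ.* 1ℤ ℤ.- s     ≡⟨ cong (λ a → a ℤ.- 1ℤ ℤ.- + 2 ℤ.* 1ℤ ℤ.- s) (ℤ.pos-+ 11 m) ⟨
      + (11 ℕ.+ m) ℤ.- 1ℤ ℤ.- + 2 ℤ.* 1ℤ ℤ.- s     ∎)
      where
      rearrange : ∀ s M → ℤ.- s ℤ.+ (+ 8 ℤ.+ M) ≡ + 11 ℤ.+ M ℤ.- 1ℤ ℤ.- + 2 ℤ.* 1ℤ ℤ.- s
      rearrange = solve-∀
    slack (inj₂ refl) = begin
      ℤ.- s ℤ.+ + (8 ℕ.+ m)                        ≤⟨ ℤ.+-monoʳ-≤ (ℤ.- s) (ℤ.+≤+ (ℕ.+-monoˡ-≤ m (ℕ.m≤m+n 8 4))) ⟩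
      ℤ.- s ℤ.+ + (12 ℕ.+ m)                       ≡⟨ cong (ℤ._+_ (ℤ.- s)) (ℤ.pos-+ 12 m) ⟩
      ℤ.- s ℤ.+ (+ 12 ℤ.+ + m)                     ≡⟨ rearrange s (+ m) ⟩
      + 11 ℤ.+ + m ℤ.- 1ℤ ℤ.- + 2 ℤ.* -1ℤ ℤ.- s    ≡⟨ cong (λ a → a ℤ.- 1ℤ ℤ.- + 2 ℤ.* -1ℤ ℤ.- s) (ℤ.pos-+ 11 m) ⟨
      + (11 ℕ.+ m) ℤ.- 1ℤ ℤ.- + 2 ℤ.* -1ℤ ℤ.- s    ∎
      where
      rearrange : ∀ s M → ℤ.- s ℤ.+ (+ 12 ℤ.+ M) ≡ + 11 ℤ.+ M ℤ.- 1ℤ ℤ.- + 2 ℤ.* -1ℤ ℤ.- s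
      rearrange = solve-∀

  ±1*±1≢1⇒≡neg : ∀ {ε c} → ε ≡ 1ℤ ⊎ ε ≡ -1ℤ → c ≡ 1ℤ ⊎ c ≡ -1ℤ → ε ℤ.* c ≢ 1ℤ → c ≡ ℤ.- ε
  ±1*±1≢1⇒≡neg (inj₁ refl) (inj₁ refl) εc≢1 = ⊥-elim (εc≢1 refl)
  ±1*±1≢1⇒≡neg (inj₁ refl) (inj₂ refl) _    = refl
  ±1*±1≢1⇒≡neg (inj₂ refl) (inj₁ refl) _    = refl
  ±1*±1≢1⇒≡neg (inj₂ refl) (inj₂ refl) εc≢1 = ⊥-elim (εc≢1 refl)

  ±1-square : ∀ {ε} → ε ≡ 1ℤ ⊎ ε ≡ -1ℤ → ∀ s → (ε ℤ.* s) ℤ.* (ε ℤ.* s) ≡ s ℤ.* s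
  ±1-square (inj₁ refl) s = cong (λ t → t ℤ.* t) (ℤ.*-identityˡ s)
  ±1-square (inj₂ refl) s = negate² s
    where
    negate² : ∀ s → (-1ℤ ℤ.* s) ℤ.* (-1ℤ ℤ.* s) ≡ s ℤ.* s
    negate² = solve-∀

  [1-±1*c]*2≤4 : ∀ {ε c} → ε ≡ 1ℤ ⊎ ε ≡ -1ℤ → -1ℤ ≤ c → c ≤ 1ℤ → (1ℤ ℤ.- ε ℤ.* c) ℤ.* + 2 ≤ + 4
  [1-±1*c]*2≤4 {ε} {c} ε≡±1 -1≤c c≤1 =
    ℤ.*-monoʳ-≤-nonNeg (+ 2) (ℤ.+-monoʳ-≤ 1ℤ (ℤ.neg-mono-≤ (-1≤εc ε≡±1)))
    where
    -1≤εc : ε ≡ 1ℤ ⊎ ε ≡ -1ℤ → -1ℤ ≤ ε ℤ.* c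
    -1≤εc (inj₁ refl) = subst (-1ℤ ≤_) (sym (ℤ.*-identityˡ c)) -1≤c
    -1≤εc (inj₂ refl) = subst (-1ℤ ≤_) (sym (ℤ.-1*i≡-i c)) (ℤ.neg-mono-≤ c≤1)

module FieldProperties (F : FiniteField) where

  open FiniteField F public

  commutativeRing : CommutativeRing _ _
  commutativeRing = record { isCommutativeRing = isCommutativeRing }

  open CommutativeRing commutativeRing public
    using (+-assoc; +-comm; +-identityˡ; +-identityʳ; -‿inverseˡ; -‿inverseʳ;
           *-assoc; *-comm; *-identityˡ; *-identityʳ; zeroˡ; zeroʳ; ring)
  open import Algebra.Properties.Ring ring public using (-‿involutive; -0#≈0#)
  open IntegerCoefficients commutativeRing public using (solve; _:=_; _:+_; _:*_; :-_; _:-_; con)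
  open FiniteSum enum _≟_ public
  open ≡-Reasoning

  1≢0 : 1# ≢ 0#
  1≢0 = 0≢1 ∘′ sym

  q : ℤ
  q = ℤ.+ order

  1<order : 1 ℕ.< order
  1<order = two-distinct (to 0#) (to 1#) (0≢1 ∘′ to-injective)
    where
    open Inverse enum using (to; from; strictlyInverseʳ)
    to-injective : ∀ {x y} → to x ≡ to y → x ≡ y
    to-injective {x} {y} eq = trans (sym (strictlyInverseʳ x)) (trans (cong from eq) (strictlyInverseʳ y))
    two-distinct : ∀ {n} (i j : Fin n) → i ≢ j → 1 ℕ.< n
    two-distinct {1} Fin.zero Fin.zero i≢j = ⊥-elim (i≢j refl)
    two-distinct {ℕ.suc (ℕ.suc _)} _ _ _ = ℕ.s≤s (ℕ.s≤s ℕ.z≤n)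

  x-y≡0⇒x≡y : ∀ {x y} → x - y ≡ 0# → x ≡ y
  x-y≡0⇒x≡y {x} {y} x-y≡0 = begin
    x             ≡⟨ solve 2 (λ x y → x := (x :- y) :+ y) refl x y ⟩
    (x - y) + y   ≡⟨ cong (_+ y) x-y≡0 ⟩
    0# + y        ≡⟨ +-identityˡ y ⟩
    y             ∎

  *-cancelˡ : ∀ {a x y} → a ≢ 0# → a * x ≡ a * y → x ≡ y
  *-cancelˡ {a} {x} {y} a≢0 ax≡ay with inverse a a≢0
  ... | a⁻¹ , aa⁻¹≡1 = begin
    x                  ≡⟨ solve 1 (λ x → x := con 1ℤ :* x) refl x ⟩
    1# * x             ≡⟨ cong (_* x) (trans (sym aa⁻¹≡1) (*-comm a a⁻¹)) ⟩
    (a⁻¹ * a) * x      ≡⟨ *-assoc a⁻¹ a x ⟩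
    a⁻¹ * (a * x)      ≡⟨ cong (a⁻¹ *_) ax≡ay ⟩
    a⁻¹ * (a * y)      ≡⟨ *-assoc a⁻¹ a y ⟨
    (a⁻¹ * a) * y      ≡⟨ cong (_* y) (trans (*-comm a⁻¹ a) aa⁻¹≡1) ⟩
    1# * y             ≡⟨ *-identityˡ y ⟩
    y                  ∎

  x≢0∧y≢0⇒x*y≢0 : ∀ {x y} → x ≢ 0# → y ≢ 0# → x * y ≢ 0#
  x≢0∧y≢0⇒x*y≢0 {x} {y} x≢0 y≢0 xy≡0 = y≢0 (*-cancelˡ x≢0 (trans xy≡0 (sym (zeroʳ x))))

  x*x≡y*y⇒x≡±y : ∀ x y → x * x ≡ y * y → x ≡ y ⊎ x ≡ - y
  x*x≡y*y⇒x≡±y x y xx≡yy with (x - y) ≟ 0#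
  ... | yes x-y≡0 = inj₁ (x-y≡0⇒x≡y x-y≡0)
  ... | no  x-y≢0 = inj₂ (x-y≡0⇒x≡y (trans (solve 2 (λ x y → x :- :- y := x :+ y) refl x y)
                                              (*-cancelˡ x-y≢0 (begin
    (x - y) * (x + y)  ≡⟨ solve 2 (λ x y → (x :- y) :* (x :+ y) := x :* x :- y :* y) refl x y ⟩
    x * x - y * y      ≡⟨ cong (_- y * y) xx≡yy ⟩
    y * y - y * y      ≡⟨ -‿inverseʳ (y * y) ⟩
    0#                 ≡⟨ zeroʳ (x - y) ⟨
    (x - y) * 0#       ∎))))

  _⁻¹ : Carrier → Carrier
  x ⁻¹ with x ≟ 0#
  ... | yes _   = 0#
  ... | no  x≢0 = proj₁ (inverse x x≢0)

  x*x⁻¹≡1 : ∀ {x} → x ≢ 0# → x * x ⁻¹ ≡ 1#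
  x*x⁻¹≡1 {x} x≢0 with x ≟ 0#
  ... | yes x≡0  = ⊥-elim (x≢0 x≡0)
  ... | no  x≢0′ = proj₂ (inverse x x≢0′)

  0⁻¹≡0 : 0# ⁻¹ ≡ 0#
  0⁻¹≡0 with 0# ≟ 0#
  ... | yes _   = refl
  ... | no  0≢0 = ⊥-elim (0≢0 refl)

  x⁻¹≢0 : ∀ {x} → x ≢ 0# → x ⁻¹ ≢ 0#
  x⁻¹≢0 {x} x≢0 x⁻¹≡0 = 1≢0 (trans (sym (x*x⁻¹≡1 x≢0)) (trans (cong (x *_) x⁻¹≡0) (zeroʳ x)))

  ⁻¹-involutive : ∀ x → x ⁻¹ ⁻¹ ≡ x
  ⁻¹-involutive x = by-cases (x ≟ 0#)
    -- a `with` on x ≟ 0# would also abstract the copy of that test inside x ⁻¹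
    where
    by-cases : Dec (x ≡ 0#) → x ⁻¹ ⁻¹ ≡ x
    by-cases (yes refl) = trans (cong _⁻¹ 0⁻¹≡0) 0⁻¹≡0
    by-cases (no  x≢0)  = *-cancelˡ (x⁻¹≢0 x≢0) (trans (x*x⁻¹≡1 (x⁻¹≢0 x≢0)) (sym (trans (*-comm _ x) (x*x⁻¹≡1 x≢0))))

  ∑-scale : ∀ {c} → c ≢ 0# → ∀ f → ∑ (λ x → f (c * x)) ≡ ∑ f
  ∑-scale {c} c≢0 f = ∑-reindex (mk↔ₛ′ (c *_) (c ⁻¹ *_) cancel cancel′) f
    where
    cancel : ∀ x → c * (c ⁻¹ * x) ≡ x
    cancel x = trans (sym (*-assoc c (c ⁻¹) x)) (trans (cong (_* x) (x*x⁻¹≡1 c≢0)) (*-identityˡ x))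
    cancel′ : ∀ x → c ⁻¹ * (c * x) ≡ x
    cancel′ x = trans (sym (*-assoc (c ⁻¹) c x)) (trans (cong (_* x) (trans (*-comm (c ⁻¹) c) (x*x⁻¹≡1 c≢0))) (*-identityˡ x))

  ∑-translate : ∀ c f → ∑ (λ x → f (x + c)) ≡ ∑ f
  ∑-translate c f = ∑-reindex (mk↔ₛ′ (_+ c) (_- c) (λ x → solve 2 (λ x c → (x :- c) :+ c := x) refl x c)
                                                   (λ x → solve 2 (λ x c → (x :+ c) :- c := x) refl x c)) f

  odd-order⇒1+1≢0 : order ℕ.% 2 ≡ 1 → 1# + 1# ≢ 0#
  odd-order⇒1+1≢0 odd 1+1≡0 with fixedPointFree-involution⇒even (_+ 1#) +1+1 +1≢id
    where
    +1+1 : ∀ x → (x + 1#) + 1# ≡ x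
    +1+1 x = trans (+-assoc x 1# 1#) (trans (cong (x +_) 1+1≡0) (+-identityʳ x))
    +1≢id : ∀ x → x + 1# ≢ x
    +1≢id x x+1≡x = 1≢0 (trans (solve 2 (λ x y → y := (x :+ y) :- x) refl x 1#)
                              (trans (cong (_- x) x+1≡x) (-‿inverseʳ x)))
  ... | t , order≡t+t = ℕ.0≢1+n (trans (sym (even%2 t)) (trans (cong (ℕ._% 2) (sym order≡t+t)) odd))
    where
    even%2 : ∀ t → (t ℕ.+ t) ℕ.% 2 ≡ 0
    even%2 t = trans (cong (λ s → (t ℕ.+ s) ℕ.% 2) (sym (ℕ.+-identityʳ t)))
                     (trans (cong (ℕ._% 2) (ℕ.*-comm 2 t)) (m*n%n≡0 t 2))

module _ (F : FiniteField) where

  open FieldProperties F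
  open import Data.Integer using (_≤_; _<_)

  module QuadraticCharacter (1+1≢0 : 1# + 1# ≢ 0#) where
    open ≡-Reasoning
    open import Algebra.Properties.AbelianGroup ℤ.+-0-abelianGroup using () renaming (∙-cancelˡ to +-cancelˡ)

    χ-0 : χ 0# ≡ 0ℤ
    χ-0 with 0# ≟ 0#
    ... | yes _   = refl
    ... | no  0≢0 = ⊥-elim (0≢0 refl)

    χ-square : ∀ {x} → x ≢ 0# → IsSquare x → χ x ≡ 1ℤ
    χ-square {x} x≢0 sq with x ≟ 0#
    ... | yes x≡0 = ⊥-elim (x≢0 x≡0)
    ... | no  _ with isSquare? x
    ...   | yes _   = refl
    ...   | no  nsq = ⊥-elim (nsq sq)

    χ-nonsquare : ∀ {x} → ¬ IsSquare x → χ x ≡ -1ℤ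
    χ-nonsquare {x} nsq with x ≟ 0#
    ... | yes refl = ⊥-elim (nsq (0# , zeroˡ 0#))
    ... | no  _ with isSquare? x
    ...   | yes sq = ⊥-elim (nsq sq)
    ...   | no  _  = refl

    data Class (x : Carrier) : Set where
      zero      : x ≡ 0# → χ x ≡ 0ℤ → Class x
      square    : x ≢ 0# → IsSquare x → χ x ≡ 1ℤ → Class x
      nonsquare : ¬ IsSquare x → χ x ≡ -1ℤ → Class x

    classify : ∀ x → Class x
    classify x with x ≟ 0#
    ... | yes refl = zero refl χ-0
    ... | no  x≢0 with isSquare? x
    ...   | yes sq  = square x≢0 sq (χ-square x≢0 sq)
    ...   | no  nsq = nonsquare nsq (χ-nonsquare nsq)

    χ-1 : χ 1# ≡ 1ℤ
    χ-1 = χ-square 1≢0 (1# , *-identityˡ 1#)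

    x*x≢0 : ∀ {x} → x ≢ 0# → x * x ≢ 0#
    x*x≢0 x≢0 = x≢0∧y≢0⇒x*y≢0 x≢0 x≢0

    x*x≢0⇒x≢0 : ∀ {x} → x * x ≢ 0# → x ≢ 0#
    x*x≢0⇒x≢0 xx≢0 refl = xx≢0 (zeroˡ 0#)

    x≢0⇒x≢-x : ∀ {x} → x ≢ 0# → x ≢ - x
    x≢0⇒x≢-x {x} x≢0 x≡-x = 1+1≢0 (*-cancelˡ x≢0 (begin
      x * (1# + 1#)   ≡⟨ solve 1 (λ x → x :* (con 1ℤ :+ con 1ℤ) := x :+ x) refl x ⟩
      x + x           ≡⟨ cong (x +_) x≡-x ⟩
      x - x           ≡⟨ -‿inverseʳ x ⟩
      0#              ≡⟨ zeroʳ x ⟨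
      x * 0#          ∎))

    square-* : ∀ {a b} → IsSquare a → IsSquare b → IsSquare (a * b)
    square-* (s , refl) (t , refl) =
      s * t , solve 2 (λ s t → (s :* t) :* (s :* t) := (s :* s) :* (t :* t)) refl s t

    square-*-cancelˡ : ∀ {s b} → s ≢ 0# → IsSquare ((s * s) * b) → IsSquare b
    square-*-cancelˡ {s} {b} s≢0 (w , ww≡ssb) with inverse s s≢0
    ... | s⁻¹ , ss⁻¹≡1 = w * s⁻¹ , (begin
      (w * s⁻¹) * (w * s⁻¹)
        ≡⟨ solve 2 (λ w t → (w :* t) :* (w :* t) := (w :* w) :* (t :* t)) refl w s⁻¹ ⟩
      (w * w) * (s⁻¹ * s⁻¹)
        ≡⟨ cong (_* (s⁻¹ * s⁻¹)) ww≡ssb ⟩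
      ((s * s) * b) * (s⁻¹ * s⁻¹)
        ≡⟨ solve 3 (λ s t b → ((s :* s) :* b) :* (t :* t) := ((s :* t) :* (s :* t)) :* b) refl s s⁻¹ b ⟩
      ((s * s⁻¹) * (s * s⁻¹)) * b
        ≡⟨ cong (λ z → (z * z) * b) ss⁻¹≡1 ⟩
      (1# * 1#) * b
        ≡⟨ solve 1 (λ b → (con 1ℤ :* con 1ℤ) :* b := b) refl b ⟩
      b                            ∎)

    χ-*-square : ∀ {s} y → s ≢ 0# → χ ((s * s) * y) ≡ χ y
    χ-*-square {s} y s≢0 with classify y
    ... | zero refl χy≡0 = trans (cong χ (zeroʳ (s * s))) (trans χ-0 (sym χy≡0))
    ... | square y≢0 sq χy≡1 =
      trans (χ-square (x≢0∧y≢0⇒x*y≢0 (x*x≢0 s≢0) y≢0) (square-* (s , refl) sq)) (sym χy≡1)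
    ... | nonsquare nsq χy≡-1 = trans (χ-nonsquare (nsq ∘ square-*-cancelˡ s≢0)) (sym χy≡-1)

    δ-squares : ∀ {z} x → z ≢ 0# → δ (x * x) (z * z) ≡ δ z x ℤ.+ δ (- z) x
    δ-squares {z} x z≢0 with x ≟ z | x ≟ (- z)
    ... | yes refl | yes x≡-x = ⊥-elim (x≢0⇒x≢-x z≢0 x≡-x)
    ... | yes refl | no  x≢-z = trans (δ-≡ refl) (sym (cong₂ ℤ._+_ (δ-≡ refl) (δ-≢ (x≢-z ∘ sym))))
    ... | no  x≢z  | yes refl =
      trans (δ-≡ (solve 1 (λ z → :- z :* :- z := z :* z) refl z)) (sym (cong₂ ℤ._+_ (δ-≢ (x≢z ∘ sym)) (δ-≡ refl)))
    ... | no  x≢z  | no  x≢-z = trans (δ-≢ xx≢zz) (sym (cong₂ ℤ._+_ (δ-≢ (x≢z ∘ sym)) (δ-≢ (x≢-z ∘ sym))))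
      where
      xx≢zz : x * x ≢ z * z
      xx≢zz xx≡zz with x*x≡y*y⇒x≡±y x z xx≡zz
      ... | inj₁ x≡z  = x≢z x≡z
      ... | inj₂ x≡-z = x≢-z x≡-z

    ∑-square-roots : ∀ y → ∑ (λ x → δ (x * x) y) ≡ 1ℤ ℤ.+ χ y
    ∑-square-roots y with classify y
    ... | zero refl χ0≡0 = begin
      ∑ (λ x → δ (x * x) 0#)  ≡⟨ ∑-cong δ-square-zero ⟩
      ∑ (δ 0#)                ≡⟨ ∑δ≡1 0# ⟩
      1ℤ                      ≡⟨ cong (ℤ._+_ 1ℤ) χ0≡0 ⟨
      1ℤ ℤ.+ χ 0#             ∎
      where
      δ-square-zero : ∀ x → δ (x * x) 0# ≡ δ 0# x
      δ-square-zero x with x ≟ 0#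
      ... | yes refl = trans (δ-≡ (zeroˡ 0#)) (sym (δ-≡ refl))
      ... | no  x≢0  = trans (δ-≢ (x*x≢0 x≢0)) (sym (δ-≢ (x≢0 ∘ sym)))
    ... | square y≢0 (z , refl) χy≡1 = begin
      ∑ (λ x → δ (x * x) (z * z))      ≡⟨ ∑-cong (λ x → δ-squares x (x*x≢0⇒x≢0 y≢0)) ⟩
      ∑ (λ x → δ z x ℤ.+ δ (- z) x)    ≡⟨ ∑-distrib-+ (δ z) (δ (- z)) ⟩
      ∑ (δ z) ℤ.+ ∑ (δ (- z))          ≡⟨ cong₂ ℤ._+_ (∑δ≡1 z) (∑δ≡1 (- z)) ⟩
      1ℤ ℤ.+ 1ℤ                        ≡⟨ cong (ℤ._+_ 1ℤ) χy≡1 ⟨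
      1ℤ ℤ.+ χ (z * z)                 ∎
    ... | nonsquare nsq χy≡-1 = begin
      ∑ (λ x → δ (x * x) y)   ≡⟨ ∑-cong (λ x → δ-≢ (λ xx≡y → nsq (x , xx≡y))) ⟩
      ∑ (λ _ → 0ℤ)            ≡⟨ ∑-zero ⟩
      0ℤ                      ≡⟨ cong (ℤ._+_ 1ℤ) χy≡-1 ⟨
      1ℤ ℤ.+ χ y              ∎

    ∑χ≡0 : ∑ χ ≡ 0ℤ
    ∑χ≡0 = +-cancelˡ q (∑ χ) 0ℤ (begin
      q ℤ.+ ∑ χ                            ≡⟨ cong (ℤ._+ ∑ χ) ∑1≡n ⟨
      ∑ (λ _ → 1ℤ) ℤ.+ ∑ χ                 ≡⟨ ∑-distrib-+ (λ _ → 1ℤ) χ ⟨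
      ∑ (λ y → 1ℤ ℤ.+ χ y)                 ≡⟨ ∑-cong ∑-square-roots ⟨
      ∑ (λ y → ∑ (λ x → δ (x * x) y))      ≡⟨ ∑-swap (λ x y → δ (x * x) y) ⟨
      ∑ (λ x → ∑ (δ (x * x)))              ≡⟨ ∑-cong (λ x → ∑δ≡1 (x * x)) ⟩
      ∑ (λ _ → 1ℤ)                         ≡⟨ ∑1≡n ⟩
      q                                    ≡⟨ ℤ.+-identityʳ q ⟨
      q ℤ.+ 0ℤ                             ∎)

    χ≢0⇒±1 : ∀ {x} → x ≢ 0# → χ x ≡ 1ℤ ⊎ χ x ≡ -1ℤ
    χ≢0⇒±1 {x} x≢0 with classify x
    ... | zero x≡0 _        = ⊥-elim (x≢0 x≡0)
    ... | square _ _ χx≡1   = inj₁ χx≡1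
    ... | nonsquare _ χx≡-1 = inj₂ χx≡-1

    -1≤χ : ∀ x → -1ℤ ≤ χ x
    -1≤χ x with classify x
    ... | zero _ χx≡0        = subst (-1ℤ ≤_) (sym χx≡0) (ℤ.-≤+)
    ... | square _ _ χx≡1    = subst (-1ℤ ≤_) (sym χx≡1) (ℤ.-≤+)
    ... | nonsquare _ χx≡-1  = subst (-1ℤ ≤_) (sym χx≡-1) ℤ.≤-refl

    χ≤1 : ∀ x → χ x ≤ 1ℤ
    χ≤1 x with classify x
    ... | zero _ χx≡0        = subst (_≤ 1ℤ) (sym χx≡0) (ℤ.+≤+ ℕ.z≤n)
    ... | square _ _ χx≡1    = subst (_≤ 1ℤ) (sym χx≡1) ℤ.≤-refl
    ... | nonsquare _ χx≡-1  = subst (_≤ 1ℤ) (sym χx≡-1) ℤ.-≤+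

    χ-nonsquare*nonsquare : ∀ {a b} → ¬ IsSquare a → ¬ IsSquare b → χ (a * b) ≡ 1ℤ
    χ-nonsquare*nonsquare {a} {b} nsqa nsqb =
      +-cancelˡ -1ℤ (χ (a * b)) 1ℤ (trans (cong (ℤ._+ χ (a * b)) (sym (χ-nonsquare nsqb)))
                                          (nonPositive∧∑≡0⇒≡0 g g≤0 ∑g≡0 b))
      where
      a≢0 : a ≢ 0#
      a≢0 refl = nsqa (0# , zeroˡ 0#)
      g : Carrier → ℤ
      g x = χ x ℤ.+ χ (a * x)
      g≤0 : ∀ x → g x ≤ 0ℤ
      g≤0 x with classify x
      ... | zero refl χ0≡0 = ℤ.≤-reflexive (cong₂ ℤ._+_ χ0≡0 (trans (cong χ (zeroʳ a)) χ-0))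
      ... | square x≢0 (s , refl) χx≡1 = ℤ.≤-reflexive (cong₂ ℤ._+_ χx≡1 (χ-nonsquare nsq-ax))
        where
        nsq-ax : ¬ IsSquare (a * (s * s))
        nsq-ax sq = nsqa (square-*-cancelˡ (x*x≢0⇒x≢0 x≢0) (subst IsSquare (*-comm a (s * s)) sq))
      ... | nonsquare _ χx≡-1 = subst (λ c → c ℤ.+ χ (a * x) ≤ 0ℤ) (sym χx≡-1) (ℤ.+-monoʳ-≤ -1ℤ (χ≤1 (a * x)))
      ∑g≡0 : ∑ g ≡ 0ℤ
      ∑g≡0 = trans (∑-distrib-+ χ (λ x → χ (a * x))) (cong₂ ℤ._+_ ∑χ≡0 (trans (∑-scale a≢0 χ) ∑χ≡0))

    χ-* : ∀ a b → χ (a * b) ≡ χ a ℤ.* χ b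
    χ-* a b with classify a | classify b
    ... | zero refl χ0≡0 | _ = trans (cong χ (zeroˡ b)) (trans χ-0 (sym (cong (ℤ._* χ b) χ0≡0)))
    ... | _ | zero refl χ0≡0 =
      trans (cong χ (zeroʳ a)) (trans χ-0 (sym (trans (cong (χ a ℤ.*_) χ0≡0) (ℤ.*-zeroʳ (χ a)))))
    ... | square a≢0 (s , refl) χa≡1 | _ =
      trans (χ-*-square b (x*x≢0⇒x≢0 a≢0)) (sym (trans (cong (ℤ._* χ b) χa≡1) (ℤ.*-identityˡ (χ b))))
    ... | nonsquare _ χa≡-1 | square b≢0 (t , refl) χb≡1 =
      trans (cong χ (*-comm a (t * t))) (trans (χ-*-square a (x*x≢0⇒x≢0 b≢0))
        (sym (trans (cong (χ a ℤ.*_) χb≡1) (ℤ.*-identityʳ (χ a)))))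
    ... | nonsquare nsqa χa≡-1 | nonsquare nsqb χb≡-1 =
      trans (χ-nonsquare*nonsquare nsqa nsqb) (sym (cong₂ ℤ._*_ χa≡-1 χb≡-1))

    χ*χ≡1 : ∀ {x} → x ≢ 0# → χ x ℤ.* χ x ≡ 1ℤ
    χ*χ≡1 {x} x≢0 with classify x
    ... | zero x≡0 _         = ⊥-elim (x≢0 x≡0)
    ... | square _ _ χx≡1    = cong (λ c → c ℤ.* c) χx≡1
    ... | nonsquare _ χx≡-1  = cong (λ c → c ℤ.* c) χx≡-1

  module CharacterSums (1+1≢0 : 1# + 1# ≢ 0#) where

    open QuadraticCharacter 1+1≢0 public
    open ≡-Reasoning

    ∑χ-translate : ∀ c → ∑ (λ x → χ (x + c)) ≡ 0ℤ
    ∑χ-translate c = trans (∑-translate c χ) ∑χ≡0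

    ∑χχ-translate : ∀ {c} → c ≢ 0# → ∑ (λ x → χ x ℤ.* χ (x + c)) ≡ -1ℤ
    ∑χχ-translate {c} c≢0 = begin
      ∑ (λ x → χ x ℤ.* χ (x + c))
        ≡⟨ ∑-reindex (mk↔ₛ′ _⁻¹ _⁻¹ ⁻¹-involutive ⁻¹-involutive) (λ x → χ x ℤ.* χ (x + c)) ⟨
      ∑ (λ x → χ (x ⁻¹) ℤ.* χ (x ⁻¹ + c))
        ≡⟨ ∑-cong term ⟩
      ∑ (λ x → χ (c * x + 1#) ℤ.- δ 0# x)
        ≡⟨ ∑-distrib-- (λ x → χ (c * x + 1#)) (δ 0#) ⟩
      ∑ (λ x → χ (c * x + 1#)) ℤ.- ∑ (δ 0#)
        ≡⟨ cong₂ ℤ._-_ ∑χ-affine (∑δ≡1 0#) ⟩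
      -1ℤ                                          ∎
      where
      ∑χ-affine : ∑ (λ x → χ (c * x + 1#)) ≡ 0ℤ
      ∑χ-affine = trans (∑-scale c≢0 (λ w → χ (w + 1#))) (∑χ-translate 1#)
      term : ∀ x → χ (x ⁻¹) ℤ.* χ (x ⁻¹ + c) ≡ χ (c * x + 1#) ℤ.- δ 0# x
      term x = by-cases (x ≟ 0#)
       where
       by-cases : Dec (x ≡ 0#) → χ (x ⁻¹) ℤ.* χ (x ⁻¹ + c) ≡ χ (c * x + 1#) ℤ.- δ 0# x
       by-cases (yes refl) = begin
        χ (0# ⁻¹) ℤ.* χ (0# ⁻¹ + c)    ≡⟨ cong (λ y → χ y ℤ.* χ (y + c)) 0⁻¹≡0 ⟩
        χ 0# ℤ.* χ (0# + c)            ≡⟨ cong (ℤ._* χ (0# + c)) χ-0 ⟩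
        1ℤ ℤ.- 1ℤ                      ≡⟨ cong₂ ℤ._-_ (trans (cong χ c0+1≡1) χ-1) (δ-≡ refl) ⟨
        χ (c * 0# + 1#) ℤ.- δ 0# 0#    ∎
        where
        c0+1≡1 : c * 0# + 1# ≡ 1#
        c0+1≡1 = trans (cong (_+ 1#) (zeroʳ c)) (+-identityˡ 1#)
       by-cases (no x≢0) = begin
        χ y ℤ.* χ (y + c)
          ≡⟨ χ-* y (y + c) ⟨
        χ (y * (y + c))
          ≡⟨ χ-*-square (y * (y + c)) x≢0 ⟨
        χ ((x * x) * (y * (y + c)))
          ≡⟨ cong χ (solve 3 (λ x y c → (x :* x) :* (y :* (y :+ c)) := (x :* y) :* ((x :* y) :+ c :* x)) refl x y c) ⟩
        χ ((x * y) * ((x * y) + c * x))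
          ≡⟨ cong (λ z → χ (z * (z + c * x))) (x*x⁻¹≡1 x≢0) ⟩
        χ (1# * (1# + c * x))
          ≡⟨ cong χ (solve 2 (λ c x → con 1ℤ :* (con 1ℤ :+ c :* x) := c :* x :+ con 1ℤ) refl c x) ⟩
        χ (c * x + 1#)
          ≡⟨ ℤ.+-identityʳ _ ⟨
        χ (c * x + 1#) ℤ.- 0ℤ
          ≡⟨ cong (ℤ._-_ (χ (c * x + 1#))) (δ-≢ (x≢0 ∘ sym)) ⟨
        χ (c * x + 1#) ℤ.- δ 0# x          ∎
        where y = x ⁻¹

    ∑χ² : ∑ (λ x → χ x ℤ.* χ x) ≡ q ℤ.- 1ℤ
    ∑χ² = begin
      ∑ (λ x → χ x ℤ.* χ x)         ≡⟨ ∑-cong term ⟩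
      ∑ (λ x → 1ℤ ℤ.- δ 0# x)       ≡⟨ ∑-distrib-- (λ _ → 1ℤ) (δ 0#) ⟩
      ∑ (λ _ → 1ℤ) ℤ.- ∑ (δ 0#)     ≡⟨ cong₂ ℤ._-_ ∑1≡n (∑δ≡1 0#) ⟩
      q ℤ.- 1ℤ                      ∎
      where
      term : ∀ x → χ x ℤ.* χ x ≡ 1ℤ ℤ.- δ 0# x
      term x = by-cases (x ≟ 0#)
        where
        by-cases : Dec (x ≡ 0#) → χ x ℤ.* χ x ≡ 1ℤ ℤ.- δ 0# x
        by-cases (yes refl) = trans (cong (λ c → c ℤ.* c) χ-0) (sym (cong (ℤ._-_ 1ℤ) (δ-≡ refl)))
        by-cases (no  x≢0)  = trans (χ*χ≡1 x≢0) (sym (cong (ℤ._-_ 1ℤ) (δ-≢ (x≢0 ∘ sym))))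

    ∑χχ : ∀ b c → ∑ (λ x → χ (x + b) ℤ.* χ (x + c)) ≡ q ℤ.* δ b c ℤ.- 1ℤ
    ∑χχ b c = begin
      ∑ (λ x → χ (x + b) ℤ.* χ (x + c))              ≡⟨ ∑-translate (- b) (λ x → χ (x + b) ℤ.* χ (x + c)) ⟨
      ∑ (λ x → χ ((x - b) + b) ℤ.* χ ((x - b) + c))  ≡⟨ ∑-cong (λ x → cong₂ (λ y z → χ y ℤ.* χ z) (x-b+b x) (x-b+c x)) ⟩
      ∑ (λ x → χ x ℤ.* χ (x + (c - b)))              ≡⟨ by-cases (b ≟ c) ⟩
      q ℤ.* δ b c ℤ.- 1ℤ                             ∎
      where
      x-b+b : ∀ x → (x - b) + b ≡ x
      x-b+b x = solve 2 (λ x b → (x :- b) :+ b := x) refl x b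
      x-b+c : ∀ x → (x - b) + c ≡ x + (c - b)
      x-b+c x = solve 3 (λ x b c → (x :- b) :+ c := x :+ (c :- b)) refl x b c
      by-cases : Dec (b ≡ c) → ∑ (λ x → χ x ℤ.* χ (x + (c - b))) ≡ q ℤ.* δ b c ℤ.- 1ℤ
      by-cases (yes refl) = begin
        ∑ (λ x → χ x ℤ.* χ (x + (b - b)))
          ≡⟨ ∑-cong (λ x → cong (λ y → χ x ℤ.* χ y) (trans (cong (x +_) (-‿inverseʳ b)) (+-identityʳ x))) ⟩
        ∑ (λ x → χ x ℤ.* χ x)
          ≡⟨ ∑χ² ⟩
        q ℤ.- 1ℤ
          ≡⟨ cong (ℤ._- 1ℤ) (trans (cong (q ℤ.*_) (δ-≡ refl)) (ℤ.*-identityʳ q)) ⟨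
        q ℤ.* δ b b ℤ.- 1ℤ                  ∎
      by-cases (no b≢c) = begin
        ∑ (λ x → χ x ℤ.* χ (x + (c - b)))   ≡⟨ ∑χχ-translate (b≢c ∘ sym ∘ x-y≡0⇒x≡y) ⟩
        -1ℤ                                 ≡⟨ cong (ℤ._- 1ℤ) (trans (cong (q ℤ.*_) (δ-≢ b≢c)) (ℤ.*-zeroʳ q)) ⟨
        q ℤ.* δ b c ℤ.- 1ℤ                  ∎

  module JacobsthalSum (1+1≢0 : 1# + 1# ≢ 0#) where

    open CharacterSums 1+1≢0 public
    open ≡-Reasoning

    φ : Carrier → ℤ
    φ e = ∑ (λ x → χ x ℤ.* χ (x * x + e))

    φ-scale : ∀ {s} e → s ≢ 0# → φ ((s * s) * e) ≡ χ s ℤ.* φ e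
    φ-scale {s} e s≢0 = begin
      φ ((s * s) * e)
        ≡⟨ ∑-scale s≢0 (λ x → χ x ℤ.* χ (x * x + (s * s) * e)) ⟨
      ∑ (λ x → χ (s * x) ℤ.* χ ((s * x) * (s * x) + (s * s) * e))
        ≡⟨ ∑-cong term ⟩
      ∑ (λ x → χ s ℤ.* (χ x ℤ.* χ (x * x + e)))
        ≡⟨ *-distribˡ-∑ (χ s) (λ x → χ x ℤ.* χ (x * x + e)) ⟨
      χ s ℤ.* φ e                                                ∎
      where
      term : ∀ x → χ (s * x) ℤ.* χ ((s * x) * (s * x) + (s * s) * e) ≡ χ s ℤ.* (χ x ℤ.* χ (x * x + e))
      term x = begin
        χ (s * x) ℤ.* χ ((s * x) * (s * x) + (s * s) * e)
          ≡⟨ cong (λ z → χ (s * x) ℤ.* χ z)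
                  (solve 3 (λ s x e → (s :* x) :* (s :* x) :+ (s :* s) :* e := (s :* s) :* (x :* x :+ e)) refl s x e) ⟩
        χ (s * x) ℤ.* χ ((s * s) * (x * x + e))   ≡⟨ cong₂ ℤ._*_ (χ-* s x) (χ-*-square (x * x + e) s≢0) ⟩
        (χ s ℤ.* χ x) ℤ.* χ (x * x + e)           ≡⟨ ℤ.*-assoc (χ s) (χ x) _ ⟩
        χ s ℤ.* (χ x ℤ.* χ (x * x + e))           ∎

    φ²-square-invariant : ∀ {e} → e ≢ 0# → IsSquare e → φ e ℤ.* φ e ≡ φ 1# ℤ.* φ 1#
    φ²-square-invariant {e} e≢0 (s , refl) = begin
      φ (s * s) ℤ.* φ (s * s)                   ≡⟨ cong (λ z → φ z ℤ.* φ z) (*-identityʳ (s * s)) ⟨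
      φ ((s * s) * 1#) ℤ.* φ ((s * s) * 1#)     ≡⟨ cong (λ z → z ℤ.* z) (φ-scale 1# s≢0) ⟩
      (χ s ℤ.* φ 1#) ℤ.* (χ s ℤ.* φ 1#)         ≡⟨ interchange (χ s) (φ 1#) ⟩
      (χ s ℤ.* χ s) ℤ.* (φ 1# ℤ.* φ 1#)         ≡⟨ cong (ℤ._* (φ 1# ℤ.* φ 1#)) (χ*χ≡1 s≢0) ⟩
      1ℤ ℤ.* (φ 1# ℤ.* φ 1#)                    ≡⟨ ℤ.*-identityˡ _ ⟩
      φ 1# ℤ.* φ 1#                             ∎
      where
      s≢0 : s ≢ 0#
      s≢0 = x*x≢0⇒x≢0 e≢0
      interchange : ∀ a b → (a ℤ.* b) ℤ.* (a ℤ.* b) ≡ (a ℤ.* a) ℤ.* (b ℤ.* b)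
      interchange = solve-∀

    module _ (χ-1≡1 : χ (- 1#) ≡ 1ℤ) where

      χ-neg : ∀ x → χ (- x) ≡ χ x
      χ-neg x = begin
        χ (- x)                  ≡⟨ cong χ (solve 1 (λ x → :- x := (:- con 1ℤ) :* x) refl x) ⟩
        χ (- 1# * x)             ≡⟨ χ-* (- 1#) x ⟩
        χ (- 1#) ℤ.* χ x         ≡⟨ cong (ℤ._* χ x) χ-1≡1 ⟩
        1ℤ ℤ.* χ x               ≡⟨ ℤ.*-identityˡ (χ x) ⟩
        χ x                      ∎

      ∑χδ-squares : ∀ x → ∑ (λ y → χ y ℤ.* δ (y * y) (x * x)) ≡ ℤ.+ 2 ℤ.* χ x
      ∑χδ-squares x = by-cases (x ≟ 0#)
        where
        by-cases : Dec (x ≡ 0#) → ∑ (λ y → χ y ℤ.* δ (y * y) (x * x)) ≡ ℤ.+ 2 ℤ.* χ x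
        by-cases (yes refl) = begin
          ∑ (λ y → χ y ℤ.* δ (y * y) (0# * 0#))   ≡⟨ ∑-cong term ⟩
          ∑ (λ _ → 0ℤ)                            ≡⟨ ∑-zero ⟩
          0ℤ                                      ≡⟨ cong (ℤ._*_ (ℤ.+ 2)) χ-0 ⟨
          ℤ.+ 2 ℤ.* χ 0#                          ∎
          where
          term : ∀ y → χ y ℤ.* δ (y * y) (0# * 0#) ≡ 0ℤ
          term y = by-cases′ (y ≟ 0#)
            where
            by-cases′ : Dec (y ≡ 0#) → χ y ℤ.* δ (y * y) (0# * 0#) ≡ 0ℤ
            by-cases′ (yes refl) = cong (ℤ._* δ (0# * 0#) (0# * 0#)) χ-0
            by-cases′ (no  y≢0)  =
              trans (cong (χ y ℤ.*_) (δ-≢ (λ yy≡00 → x*x≢0 y≢0 (trans yy≡00 (zeroˡ 0#))))) (ℤ.*-zeroʳ (χ y))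
        by-cases (no x≢0) = begin
          ∑ (λ y → χ y ℤ.* δ (y * y) (x * x))
            ≡⟨ ∑-cong (λ y → trans (cong (χ y ℤ.*_) (δ-squares y x≢0)) (distrib y)) ⟩
          ∑ (λ y → δ x y ℤ.* χ y ℤ.+ δ (- x) y ℤ.* χ y)
            ≡⟨ ∑-distrib-+ (λ y → δ x y ℤ.* χ y) (λ y → δ (- x) y ℤ.* χ y) ⟩
          ∑ (λ y → δ x y ℤ.* χ y) ℤ.+ ∑ (λ y → δ (- x) y ℤ.* χ y)
            ≡⟨ cong₂ ℤ._+_ (∑-δ x χ) (trans (∑-δ (- x) χ) (χ-neg x)) ⟩
          χ x ℤ.+ χ x
            ≡⟨ double (χ x) ⟩
          ℤ.+ 2 ℤ.* χ x                                     ∎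
          where
          distrib : ∀ y → χ y ℤ.* (δ x y ℤ.+ δ (- x) y) ≡ δ x y ℤ.* χ y ℤ.+ δ (- x) y ℤ.* χ y
          distrib y = distribʳ (χ y) (δ x y) (δ (- x) y)
            where
            distribʳ : ∀ c a b → c ℤ.* (a ℤ.+ b) ≡ a ℤ.* c ℤ.+ b ℤ.* c
            distribʳ = solve-∀
          double : ∀ a → a ℤ.+ a ≡ ℤ.+ 2 ℤ.* a
          double = solve-∀

      ∑φ² : ∑ (λ e → φ e ℤ.* φ e) ≡ ℤ.+ 2 ℤ.* q ℤ.* (q ℤ.- 1ℤ)
      ∑φ² = begin
        ∑ (λ e → φ e ℤ.* φ e)
          ≡⟨ ∑-cong (λ e → ∑*∑ (λ x → χ x ℤ.* χ (x * x + e)) (λ y → χ y ℤ.* χ (y * y + e))) ⟩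
        ∑ (λ e → ∑ (λ x → ∑ (λ y → T x y e)))
          ≡⟨ ∑-swap (λ e x → ∑ (λ y → T x y e)) ⟩
        ∑ (λ x → ∑ (λ e → ∑ (λ y → T x y e)))
          ≡⟨ ∑-cong (λ x → ∑-swap (λ e y → T x y e)) ⟩
        ∑ (λ x → ∑ (λ y → ∑ (T x y)))
          ≡⟨ ∑-cong (λ x → ∑-cong (∑T x)) ⟩
        ∑ (λ x → ∑ (λ y → χ x ℤ.* χ y ℤ.* (q ℤ.* δ (y * y) (x * x) ℤ.- 1ℤ)))
          ≡⟨ ∑-cong row ⟩
        ∑ (λ x → ℤ.+ 2 ℤ.* q ℤ.* (χ x ℤ.* χ x))
          ≡⟨ *-distribˡ-∑ (ℤ.+ 2 ℤ.* q) (λ x → χ x ℤ.* χ x) ⟨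
        ℤ.+ 2 ℤ.* q ℤ.* ∑ (λ x → χ x ℤ.* χ x)
          ≡⟨ cong (ℤ._*_ (ℤ.+ 2 ℤ.* q)) ∑χ² ⟩
        ℤ.+ 2 ℤ.* q ℤ.* (q ℤ.- 1ℤ)                         ∎
        where
        T : Carrier → Carrier → Carrier → ℤ
        T x y e = (χ x ℤ.* χ (x * x + e)) ℤ.* (χ y ℤ.* χ (y * y + e))

        ∑T : ∀ x y → ∑ (T x y) ≡ χ x ℤ.* χ y ℤ.* (q ℤ.* δ (y * y) (x * x) ℤ.- 1ℤ)
        ∑T x y = begin
          ∑ (T x y)
            ≡⟨ ∑-cong regroup ⟩
          ∑ (λ e → χ x ℤ.* χ y ℤ.* (χ (e + y * y) ℤ.* χ (e + x * x)))
            ≡⟨ *-distribˡ-∑ (χ x ℤ.* χ y) (λ e → χ (e + y * y) ℤ.* χ (e + x * x)) ⟨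
          χ x ℤ.* χ y ℤ.* ∑ (λ e → χ (e + y * y) ℤ.* χ (e + x * x))
            ≡⟨ cong (ℤ._*_ (χ x ℤ.* χ y)) (∑χχ (y * y) (x * x)) ⟩
          χ x ℤ.* χ y ℤ.* (q ℤ.* δ (y * y) (x * x) ℤ.- 1ℤ)          ∎
          where
          regroup : ∀ e → T x y e ≡ χ x ℤ.* χ y ℤ.* (χ (e + y * y) ℤ.* χ (e + x * x))
          regroup e = trans (reorder (χ x) (χ y) (χ (x * x + e)) (χ (y * y + e)))
                            (cong₂ (λ a b → χ x ℤ.* χ y ℤ.* (χ a ℤ.* χ b)) (+-comm (y * y) e) (+-comm (x * x) e))
            where
            reorder : ∀ a b c d → (a ℤ.* c) ℤ.* (b ℤ.* d) ≡ a ℤ.* b ℤ.* (d ℤ.* c)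
            reorder = solve-∀

        row : ∀ x → ∑ (λ y → χ x ℤ.* χ y ℤ.* (q ℤ.* δ (y * y) (x * x) ℤ.- 1ℤ)) ≡ ℤ.+ 2 ℤ.* q ℤ.* (χ x ℤ.* χ x)
        row x = begin
          ∑ (λ y → χ x ℤ.* χ y ℤ.* (q ℤ.* δ (y * y) (x * x) ℤ.- 1ℤ))
            ≡⟨ ∑-cong (λ y → expand q (χ x) (χ y) (δ (y * y) (x * x))) ⟩
          ∑ (λ y → q ℤ.* χ x ℤ.* (χ y ℤ.* δ (y * y) (x * x)) ℤ.- χ x ℤ.* χ y)
            ≡⟨ ∑-distrib-- (λ y → q ℤ.* χ x ℤ.* (χ y ℤ.* δ (y * y) (x * x))) (λ y → χ x ℤ.* χ y) ⟩
          ∑ (λ y → q ℤ.* χ x ℤ.* (χ y ℤ.* δ (y * y) (x * x))) ℤ.- ∑ (λ y → χ x ℤ.* χ y)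
            ≡⟨ cong₂ ℤ._-_ (*-distribˡ-∑ (q ℤ.* χ x) (λ y → χ y ℤ.* δ (y * y) (x * x))) (*-distribˡ-∑ (χ x) χ) ⟨
          q ℤ.* χ x ℤ.* ∑ (λ y → χ y ℤ.* δ (y * y) (x * x)) ℤ.- χ x ℤ.* ∑ χ
            ≡⟨ cong₂ (λ a b → q ℤ.* χ x ℤ.* a ℤ.- χ x ℤ.* b) (∑χδ-squares x) ∑χ≡0 ⟩
          q ℤ.* χ x ℤ.* (ℤ.+ 2 ℤ.* χ x) ℤ.- χ x ℤ.* 0ℤ
            ≡⟨ collect q (χ x) ⟩
          ℤ.+ 2 ℤ.* q ℤ.* (χ x ℤ.* χ x) ∎
          where
          expand : ∀ q a b d → a ℤ.* b ℤ.* (q ℤ.* d ℤ.- 1ℤ) ≡ q ℤ.* a ℤ.* (b ℤ.* d) ℤ.- a ℤ.* b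
          expand = solve-∀
          collect : ∀ q a → q ℤ.* a ℤ.* (ℤ.+ 2 ℤ.* a) ℤ.- a ℤ.* 0ℤ ≡ ℤ.+ 2 ℤ.* q ℤ.* (a ℤ.* a)
          collect = solve-∀

      φ²≤4q : ∀ {e} → e ≢ 0# → IsSquare e → φ e ℤ.* φ e ≤ ℤ.+ 4 ℤ.* q
      φ²≤4q e≢0 sq = subst (_≤ ℤ.+ 4 ℤ.* q) (sym (φ²-square-invariant e≢0 sq)) (q-1-cancel
        (ℤ.≤-trans (ℤ.≤-reflexive weighted-sum)
                   (ℤ.≤-trans (∑-mono-≤ (λ e → w≤2 e (0≤i*i (φ e)))) (ℤ.≤-reflexive doubled-sum))))
        where
        φ1² : ℤ
        φ1² = φ 1# ℤ.* φ 1#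

        -- w e is 2 on the nonzero squares and 0 elsewhere
        w : Carrier → ℤ
        w e = χ e ℤ.* χ e ℤ.+ χ e

        ∑w≡q-1 : ∑ w ≡ q ℤ.- 1ℤ
        ∑w≡q-1 = trans (∑-distrib-+ (λ e → χ e ℤ.* χ e) χ) (trans (cong₂ ℤ._+_ ∑χ² ∑χ≡0) (ℤ.+-identityʳ _))

        weighted-invariant : ∀ e → w e ℤ.* (φ e ℤ.* φ e) ≡ w e ℤ.* φ1²
        weighted-invariant e with classify e
        ... | zero _ χe≡0          rewrite χe≡0  = refl
        ... | square e≢0 sq _                    = cong (w e ℤ.*_) (φ²-square-invariant e≢0 sq)
        ... | nonsquare _ χe≡-1    rewrite χe≡-1 = refl

        w≤2 : ∀ e {i} → 0ℤ ≤ i → w e ℤ.* i ≤ ℤ.+ 2 ℤ.* i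
        w≤2 e 0≤i with classify e
        ... | zero _ χe≡0          rewrite χe≡0  = ℤ.*-monoˡ-≤-nonNeg (ℤ.+ 2) 0≤i
        ... | square _ _ χe≡1      rewrite χe≡1  = ℤ.≤-refl
        ... | nonsquare _ χe≡-1    rewrite χe≡-1 = ℤ.*-monoˡ-≤-nonNeg (ℤ.+ 2) 0≤i

        0≤i*i : ∀ i → 0ℤ ≤ i ℤ.* i
        0≤i*i (ℤ.+ n)     = subst (0ℤ ≤_) (ℤ.pos-* n n) (ℤ.+≤+ ℕ.z≤n)
        0≤i*i ℤ.-[1+ n ]  = ℤ.+≤+ ℕ.z≤n

        q-1-cancel : ∀ {i j} → (q ℤ.- 1ℤ) ℤ.* i ≤ (q ℤ.- 1ℤ) ℤ.* j → i ≤ j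
        q-1-cancel = cancel 1<order
          where
          cancel : ∀ {n i j} → 1 ℕ.< n → (ℤ.+ n ℤ.- 1ℤ) ℤ.* i ≤ (ℤ.+ n ℤ.- 1ℤ) ℤ.* j → i ≤ j
          cancel {suc (suc k)} {i} {j} (ℕ.s≤s (ℕ.s≤s _)) = ℤ.*-cancelˡ-≤-pos i j (ℤ.+ suc k)

        rearrange : ∀ q → ℤ.+ 2 ℤ.* (ℤ.+ 2 ℤ.* q ℤ.* (q ℤ.- 1ℤ)) ≡ (q ℤ.- 1ℤ) ℤ.* (ℤ.+ 4 ℤ.* q)
        rearrange = solve-∀

        weighted-sum : (q ℤ.- 1ℤ) ℤ.* φ1² ≡ ∑ (λ e → w e ℤ.* (φ e ℤ.* φ e))
        weighted-sum = begin
          (q ℤ.- 1ℤ) ℤ.* φ1²                 ≡⟨ cong (ℤ._* φ1²) ∑w≡q-1 ⟨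
          ∑ w ℤ.* φ1²                        ≡⟨ *-distribʳ-∑ φ1² w ⟩
          ∑ (λ e → w e ℤ.* φ1²)              ≡⟨ ∑-cong weighted-invariant ⟨
          ∑ (λ e → w e ℤ.* (φ e ℤ.* φ e))    ∎

        doubled-sum : ∑ (λ e → ℤ.+ 2 ℤ.* (φ e ℤ.* φ e)) ≡ (q ℤ.- 1ℤ) ℤ.* (ℤ.+ 4 ℤ.* q)
        doubled-sum = begin
          ∑ (λ e → ℤ.+ 2 ℤ.* (φ e ℤ.* φ e))      ≡⟨ *-distribˡ-∑ (ℤ.+ 2) (λ e → φ e ℤ.* φ e) ⟨
          ℤ.+ 2 ℤ.* ∑ (λ e → φ e ℤ.* φ e)        ≡⟨ cong (ℤ._*_ (ℤ.+ 2)) ∑φ² ⟩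
          ℤ.+ 2 ℤ.* (ℤ.+ 2 ℤ.* q ℤ.* (q ℤ.- 1ℤ)) ≡⟨ rearrange q ⟩
          (q ℤ.- 1ℤ) ℤ.* (ℤ.+ 4 ℤ.* q)          ∎

  module ConsecutiveNonsquares (1+1≢0 : 1# + 1# ≢ 0#) where

    open JacobsthalSum 1+1≢0
    open IntegerBounds
    open ≡-Reasoning

    S : ℤ
    S = ∑ (λ u → χ (u - 1#) ℤ.* χ u ℤ.* χ (u + 1#))

    S≡φ[-1] : S ≡ φ (- 1#)
    S≡φ[-1] = ∑-cong term
      where
      term : ∀ u → χ (u - 1#) ℤ.* χ u ℤ.* χ (u + 1#) ≡ χ u ℤ.* χ (u * u + - 1#)
      term u = begin
        χ (u - 1#) ℤ.* χ u ℤ.* χ (u + 1#)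
          ≡⟨ regroup (χ (u - 1#)) (χ u) (χ (u + 1#)) ⟩
        χ u ℤ.* (χ (u - 1#) ℤ.* χ (u + 1#))
          ≡⟨ cong (χ u ℤ.*_) (χ-* (u - 1#) (u + 1#)) ⟨
        χ u ℤ.* χ ((u - 1#) * (u + 1#))
          ≡⟨ cong (λ z → χ u ℤ.* χ z) (solve 1 (λ u → (u :- con 1ℤ) :* (u :+ con 1ℤ) := u :* u :+ :- con 1ℤ) refl u) ⟩
        χ u ℤ.* χ (u * u + - 1#)               ∎
        where
        regroup : ∀ a b c → a ℤ.* b ℤ.* c ≡ b ℤ.* (a ℤ.* c)
        regroup = solve-∀

    φ≡0 : χ (- 1#) ≡ -1ℤ → ∀ e → φ e ≡ 0ℤ
    φ≡0 χ-1≡-1 e = self-negative (begin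
      φ e
        ≡⟨ ∑-reindex (mk↔ₛ′ -_ -_ -‿involutive -‿involutive) (λ x → χ x ℤ.* χ (x * x + e)) ⟨
      ∑ (λ x → χ (- x) ℤ.* χ (- x * - x + e))
        ≡⟨ ∑-cong term ⟩
      ∑ (λ x → ℤ.- (χ x ℤ.* χ (x * x + e)))
        ≡⟨ ∑-neg (λ x → χ x ℤ.* χ (x * x + e)) ⟩
      ℤ.- φ e                                      ∎)
      where
      self-negative : ∀ {i} → i ≡ ℤ.- i → i ≡ 0ℤ
      self-negative {ℤ.+ 0}     _  = refl
      self-negative {ℤ.+ suc _} ()
      self-negative {ℤ.-[1+ _ ]} ()
      term : ∀ x → χ (- x) ℤ.* χ (- x * - x + e) ≡ ℤ.- (χ x ℤ.* χ (x * x + e))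
      term x = begin
        χ (- x) ℤ.* χ (- x * - x + e)
          ≡⟨ cong₂ (λ y z → χ y ℤ.* χ (z + e)) (solve 1 (λ x → :- x := :- con 1ℤ :* x) refl x)
                                                (solve 1 (λ x → :- x :* :- x := x :* x) refl x) ⟩
        χ (- 1# * x) ℤ.* χ (x * x + e)
          ≡⟨ cong (ℤ._* χ (x * x + e)) (trans (χ-* (- 1#) x) (cong (ℤ._* χ x) χ-1≡-1)) ⟩
        -1ℤ ℤ.* χ x ℤ.* χ (x * x + e)
          ≡⟨ trans (ℤ.*-assoc -1ℤ (χ x) _) (ℤ.-1*i≡-i _) ⟩
        ℤ.- (χ x ℤ.* χ (x * x + e))               ∎

    P : ℤ → Carrier → ℤ
    P ε u = (1ℤ ℤ.- ε ℤ.* χ (u - 1#)) ℤ.* (1ℤ ℤ.- χ u) ℤ.* (1ℤ ℤ.- χ (u + 1#))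

    x+1-1≡x : ∀ x → (x + 1#) - 1# ≡ x
    x+1-1≡x x = solve 1 (λ x → (x :+ con 1ℤ) :- con 1ℤ := x) refl x

    ∑P : ∀ ε → ∑ (P ε) ≡ q ℤ.- 1ℤ ℤ.- ℤ.+ 2 ℤ.* ε ℤ.- ε ℤ.* S
    ∑P ε = trans (∑-expand₃ (λ u → ε ℤ.* A u) χ C)
                 (collect (pull-ε (λ u → ε ℤ.* A u) A (λ _ → refl) (∑χ-translate (- 1#)))
                          ∑χ≡0
                          (∑χ-translate 1#)
                          (pull-ε (λ u → ε ℤ.* A u ℤ.* χ u) (λ u → A u ℤ.* χ u) (λ u → ℤ.*-assoc ε (A u) (χ u)) ∑AB)
                          (∑χχ-translate 1≢0)
                          (pull-ε (λ u → ε ℤ.* A u ℤ.* C u) (λ u → A u ℤ.* C u) (λ u → ℤ.*-assoc ε (A u) (C u)) ∑AC)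
                          (pull-ε (λ u → ε ℤ.* A u ℤ.* χ u ℤ.* C u) (λ u → A u ℤ.* χ u ℤ.* C u)
                                  (λ u → reassoc ε (A u) (χ u) (C u)) refl))
      where
      A C : Carrier → ℤ
      A u = χ (u - 1#)
      C u = χ (u + 1#)

      pull-ε : ∀ (f g : Carrier → ℤ) {s} → (∀ u → f u ≡ ε ℤ.* g u) → ∑ g ≡ s → ∑ f ≡ ε ℤ.* s
      pull-ε f g f≡εg ∑g≡s = trans (∑-cong f≡εg) (trans (sym (*-distribˡ-∑ ε g)) (cong (ε ℤ.*_) ∑g≡s))

      reassoc : ∀ e a b c → e ℤ.* a ℤ.* b ℤ.* c ≡ e ℤ.* (a ℤ.* b ℤ.* c)
      reassoc = solve-∀

      ∑AB : ∑ (λ u → A u ℤ.* χ u) ≡ -1ℤ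
      ∑AB = trans (sym (∑-translate 1# (λ u → A u ℤ.* χ u)))
                  (trans (∑-cong (λ x → cong (λ y → χ y ℤ.* C x) (x+1-1≡x x))) (∑χχ-translate 1≢0))

      ∑AC : ∑ (λ u → A u ℤ.* C u) ≡ -1ℤ
      ∑AC = trans (sym (∑-translate 1# (λ u → A u ℤ.* C u)))
                  (trans (∑-cong (λ x → cong₂ (λ y z → χ y ℤ.* χ z) (x+1-1≡x x) (+-assoc x 1# 1#))) (∑χχ-translate 1+1≢0))

      collect : ∀ {sa sb sc sab sbc sac sabc} →
        sa ≡ ε ℤ.* 0ℤ → sb ≡ 0ℤ → sc ≡ 0ℤ → sab ≡ ε ℤ.* -1ℤ → sbc ≡ -1ℤ → sac ≡ ε ℤ.* -1ℤ → sabc ≡ ε ℤ.* S →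
        q ℤ.- sa ℤ.- sb ℤ.- sc ℤ.+ sab ℤ.+ sbc ℤ.+ sac ℤ.- sabc ≡ q ℤ.- 1ℤ ℤ.- ℤ.+ 2 ℤ.* ε ℤ.- ε ℤ.* S
      collect refl refl refl refl refl refl refl = simplify q ε S
        where
        simplify : ∀ q ε S → q ℤ.- ε ℤ.* 0ℤ ℤ.- 0ℤ ℤ.- 0ℤ ℤ.+ ε ℤ.* -1ℤ ℤ.+ -1ℤ ℤ.+ ε ℤ.* -1ℤ ℤ.- ε ℤ.* S
                             ≡ q ℤ.- 1ℤ ℤ.- ℤ.+ 2 ℤ.* ε ℤ.- ε ℤ.* S
        simplify = solve-∀

    positive⇒≢1 : ∀ x y z → 0ℤ < (1ℤ ℤ.- x) ℤ.* (1ℤ ℤ.- y) ℤ.* (1ℤ ℤ.- z) → x ≢ 1ℤ × y ≢ 1ℤ × z ≢ 1ℤ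
    positive⇒≢1 x y z pos = (λ { refl → vanishes refl })
                          , (λ { refl → vanishes (cong (ℤ._* (1ℤ ℤ.- z)) (ℤ.*-zeroʳ (1ℤ ℤ.- x))) })
                          , (λ { refl → vanishes (ℤ.*-zeroʳ ((1ℤ ℤ.- x) ℤ.* (1ℤ ℤ.- y))) })
      where
      vanishes : (1ℤ ℤ.- x) ℤ.* (1ℤ ℤ.- y) ℤ.* (1ℤ ℤ.- z) ≡ 0ℤ → ⊥
      vanishes product≡0 = ℤ.<-irrefl refl (subst (0ℤ <_) product≡0 pos)

    P-positive⇒run : ∀ {ε u} → ε ≡ 1ℤ ⊎ ε ≡ -1ℤ → u ≢ - 1# → 0ℤ < P ε u →
                     χ (u - 1#) ≡ ℤ.- ε × χ u ≡ -1ℤ × χ (u + 1#) ≡ -1ℤ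
    P-positive⇒run {ε} {u} ε≡±1 u≢-1 pos with positive⇒≢1 (ε ℤ.* χ (u - 1#)) (χ u) (χ (u + 1#)) pos
    ... | εA≢1 , B≢1 , C≢1 = ±1*±1≢1⇒≡neg ε≡±1 (χ≢0⇒±1 u-1≢0) εA≢1 , ≢1⇒-1 u≢0 B≢1 , ≢1⇒-1 u+1≢0 C≢1
      where
      ≢1⇒-1 : ∀ {x} → x ≢ 0# → χ x ≢ 1ℤ → χ x ≡ -1ℤ
      ≢1⇒-1 x≢0 χx≢1 with χ≢0⇒±1 x≢0
      ... | inj₁ χx≡1  = ⊥-elim (χx≢1 χx≡1)
      ... | inj₂ χx≡-1 = χx≡-1
      u+1≢0 : u + 1# ≢ 0#
      u+1≢0 u+1≡0 = u≢-1 (trans (sym (x+1-1≡x u)) (trans (cong (_- 1#) u+1≡0) (+-identityˡ (- 1#))))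
      u≢0 : u ≢ 0#
      u≢0 refl = C≢1 (trans (cong χ (+-identityˡ 1#)) χ-1)
      u-1≢0 : u - 1# ≢ 0#
      u-1≢0 u-1≡0 = B≢1 (trans (cong χ (x-y≡0⇒x≡y u-1≡0)) χ-1)

    P[-1]<∑P : ∀ m {ε} → order ≡ 11 ℕ.+ m → ε ≡ 1ℤ ⊎ ε ≡ -1ℤ → P ε (- 1#) < ∑ (P ε)
    P[-1]<∑P m {ε} order≡11+m ε≡±1 =
      subst (P ε (- 1#) <_) (sym ∑P≡) (s+p<q-3⇒p<q-1-2ε-s m {ε} {ε ℤ.* S} {P ε (- 1#)} ε≡±1 bound)
      where
      ∑P≡ : ∑ (P ε) ≡ ℤ.+ (11 ℕ.+ m) ℤ.- 1ℤ ℤ.- ℤ.+ 2 ℤ.* ε ℤ.- ε ℤ.* S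
      ∑P≡ = trans (∑P ε) (cong (λ n → ℤ.+ n ℤ.- 1ℤ ℤ.- ℤ.+ 2 ℤ.* ε ℤ.- ε ℤ.* S) order≡11+m)

      χ[-1+1]≡0 : χ (- 1# + 1#) ≡ 0ℤ
      χ[-1+1]≡0 = trans (cong χ (-‿inverseˡ 1#)) χ-0

      a : ℤ
      a = 1ℤ ℤ.- ε ℤ.* χ (- 1# - 1#)

      P[-1]≡ : ∀ {c} → χ (- 1#) ≡ c → P ε (- 1#) ≡ a ℤ.* (1ℤ ℤ.- c) ℤ.* 1ℤ
      P[-1]≡ χ-1≡c = cong₂ (λ b c → a ℤ.* (1ℤ ℤ.- b) ℤ.* (1ℤ ℤ.- c)) χ-1≡c χ[-1+1]≡0

      bound : ε ℤ.* S ℤ.+ P ε (- 1#) < ℤ.+ (8 ℕ.+ m)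
      bound with classify (- 1#)
      ... | zero -1≡0 _ = ⊥-elim (1≢0 (trans (sym (-‿involutive 1#)) (trans (cong -_ -1≡0) -0#≈0#)))
      ... | square -1≢0 -1-square χ-1≡1 =
        subst (_< ℤ.+ (8 ℕ.+ m)) (sym εS+P[-1]≡εS) (T²≤4q⇒T<q-3 m (ε ℤ.* S) εS²≤)
        where
        εS+P[-1]≡εS : ε ℤ.* S ℤ.+ P ε (- 1#) ≡ ε ℤ.* S
        εS+P[-1]≡εS = trans (cong (ℤ._+_ (ε ℤ.* S)) (trans (P[-1]≡ χ-1≡1) (cong (ℤ._* 1ℤ) (ℤ.*-zeroʳ a))))
                            (ℤ.+-identityʳ (ε ℤ.* S))
        εS²≤ : (ε ℤ.* S) ℤ.* (ε ℤ.* S) ≤ ℤ.+ 4 ℤ.* ℤ.+ (11 ℕ.+ m)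
        εS²≤ = subst₂ _≤_ (sym (trans (±1-square ε≡±1 S) (cong (λ s → s ℤ.* s) S≡φ[-1])))
                          (cong (λ n → ℤ.+ 4 ℤ.* ℤ.+ n) order≡11+m)
                          (φ²≤4q χ-1≡1 -1≢0 -1-square)
      ... | nonsquare _ χ-1≡-1 = ℤ.≤-<-trans εS+P[-1]≤4 (ℤ.+<+ (ℕ.s≤s (ℕ.m≤m+n 4 (3 ℕ.+ m))))
        where
        εS≡0 : ε ℤ.* S ≡ 0ℤ
        εS≡0 = trans (cong (ε ℤ.*_) (trans S≡φ[-1] (φ≡0 χ-1≡-1 (- 1#)))) (ℤ.*-zeroʳ ε)
        εS+P[-1]≤4 : ε ℤ.* S ℤ.+ P ε (- 1#) ≤ ℤ.+ 4
        εS+P[-1]≤4 = subst (_≤ ℤ.+ 4) (sym εS+P[-1]≡) ([1-±1*c]*2≤4 ε≡±1 (-1≤χ (- 1# - 1#)) (χ≤1 (- 1# - 1#)))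
          where
          εS+P[-1]≡ : ε ℤ.* S ℤ.+ P ε (- 1#) ≡ a ℤ.* ℤ.+ 2
          εS+P[-1]≡ = trans (cong₂ ℤ._+_ εS≡0 (trans (P[-1]≡ χ-1≡-1) (ℤ.*-identityʳ (a ℤ.* ℤ.+ 2))))
                            (ℤ.+-identityˡ (a ℤ.* ℤ.+ 2))

    ∃-run : ∀ m {ε} → order ≡ 11 ℕ.+ m → ε ≡ 1ℤ ⊎ ε ≡ -1ℤ →
           ∃ λ u → χ (u - 1#) ≡ ℤ.- ε × χ u ≡ -1ℤ × χ (u + 1#) ≡ -1ℤ
    ∃-run m {ε} order≡11+m ε≡±1 =
      map₂ (λ (u≢-1 , 0<Pu) → P-positive⇒run ε≡±1 u≢-1 0<Pu)
           (term<∑⇒∃positive (- 1#) (P ε) (P[-1]<∑P m order≡11+m ε≡±1))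


open import Data.Nat using (_<_; _%_)
open FiniteField using (Carrier; χ; order; _+_; _-_; 1#)

odd∧9<n⇒11≤n : ∀ n → n % 2 ≡ 1 → 9 < n → 11 ℕ.≤ n
odd∧9<n⇒11≤n n odd 9<n = ℕ.≤∧≢⇒< 9<n 10≢n
  where
  10≢n : 10 ≢ n
  10≢n refl = ℕ.0≢1+n odd

lemma2p2 : (F : FiniteField) → order F % 2 ≡ 1 → 9 < order F →
    ∃₂ λ (u v : Carrier F) →
      (χ F u ≡ -1ℤ) × (χ F v ≡ -1ℤ) ×
      (χ F (_+_ F u (1# F)) ≡ -1ℤ) × (χ F (_+_ F v (1# F)) ≡ -1ℤ) ×
      (χ F (_-_ F u (1# F)) ≡ -1ℤ) × (χ F (_-_ F v (1# F)) ≡ 1ℤ)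
lemma2p2 F odd 9<order =
  let (u , χu-1≡-1 , χu≡-1 , χu+1≡-1) = ∃-run m order≡11+m (inj₁ refl)
      (v , χv-1≡1 , χv≡-1 , χv+1≡-1)  = ∃-run m order≡11+m (inj₂ refl)
  in u , v , χu≡-1 , χv≡-1 , χu+1≡-1 , χv+1≡-1 , χu-1≡-1 , χv-1≡1
  where
  open ConsecutiveNonsquares F (FieldProperties.odd-order⇒1+1≢0 F odd)
  m : ℕ
  m = order F ℕ.∸ 11
  order≡11+m : order F ≡ 11 ℕ.+ m
  order≡11+m = sym (ℕ.m+[n∸m]≡n (odd∧9<n⇒11≤n (order F) odd 9<order))
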